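{- Let $d \geq 2$ and let $w_1^1, w_1^2, w_2, \ldots, w_d$ be a basis of $\mathbb{R}^{d+1}$ consisting of eigenvectors of $\mathfrak{H}_{d-1}$, where $w_1^1, w_1^2$ are eigenvectors for the eigenvalue $1$ and $w_i$ is an eigenvector for the eigenvalue $i!$, $2 \leq i \leq d$. Then: (i) for every $(d-1)$-dimensional simplicial complex $\Delta$, if $\mathfrak{h}^\Delta = (h_0^\Delta,\dots,h_d^\Delta) = a_1^1 w_1^1 + a_1^2 w_1^2 + \sum_{i=2}^d a_i w_i$, then $a_d \neq 0$; (ii) the first and the last coordinates of each of $w_2, \ldots, w_d$ are zero; (iii) $w_1^1$ and $w_1^2$ can be chosen of the form $w_1^1 = (1, i_1, \ldots, i_{d-1}, 0)$ and $w_1^2 = (0, j_1, \ldots, j_{d-1}, 1)$; (iv) $w_d$ can be chosen of the form $w_d = (0, a_1, \ldots, a_{d-1}, 0)$ with $a_1,\dots,a_{d-1}$ strictly positive rational numbers.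
   Context: For $\sigma \in S_m$, $\mathrm{des}(\sigma) = \#\{ k \in [m-1] : \sigma(k) > \sigma(k+1)\}$, and $A(m,i,j)$ is the number of $\sigma\in S_m$ with $\sigma(1)=j$ and $\mathrm{des}(\sigma)=i$. $\mathfrak{H}_{d-1}=(H_{ij})_{0\le i,j\le d}$ is the $(d+1)\times(d+1)$ matrix with $H_{ij}=A(d+1,i,j+1)$ (its eigenvalues are $1$ with multiplicity 2 and $2!,\dots,d!$, and it is diagonalizable). For a $(d-1)$-dimensional simplicial complex, $f_{i}^\Delta$ ($-1 \le i \le d-1$) is the number of $i$-dimensional faces ($f_{ -1}^\Delta=1$), and the $h$-vector is defined by $\sum_{i=0}^d h_i^\Delta t^{d-i} = \sum_{i=0}^d f_{i-1}^\Delta (t-1)^{d-i}$.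
   Formalization: The eigenvectors $w_1^1, w_1^2, w_2, \ldots, w_d$ form a basis of ℚ^(d+1) rather than of $\mathbb{R}^{d+1}$, and the coefficients of the h-vector in this basis are rational. -}

module Defs where

open import Data.Bool using (Bool; true; false; if_then_else_)
open import Data.Nat as ℕ using (ℕ; zero; suc; _≤_; _<ᵇ_; _≡ᵇ_)
open import Data.Nat.Combinatorics using (_C_)
open import Data.Nat.Base using (_!)
open import Data.Integer as ℤ using (ℤ; +_)
open import Data.Rational as ℚ using (ℚ; 0ℚ; 1ℚ)
open import Data.Fin using (Fin; toℕ; fromℕ)
import Data.Fin as F
open import Data.Fin.Subset using (Subset; _⊆_; ∣_∣; ⊥)
open import Data.List as L using (List; []; _∷_; _++_; concatMap; map; length; filter; upTo)
open import Data.Vec as V using (Vec; []; _∷_)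
open import Data.Vec.Functional using (Vector; updateAt)
open import Data.Product using (Σ; ∃; _×_; _,_)
open import Relation.Binary.PropositionalEquality using (_≡_; _≢_)
open import Relation.Nullary using (¬_)
open import Relation.Nullary.Decidable using (⌊_⌋)

-- Permutations of S_m, written in one-line notation as lists
-- (σ(1), ..., σ(m)) of the numbers 1..m.

insertions : ℕ → List ℕ → List (List ℕ)
insertions x []       = (x ∷ []) ∷ []
insertions x (y ∷ ys) = (x ∷ y ∷ ys) ∷ map (y ∷_) (insertions x ys)

perms : ℕ → List (List ℕ)
perms zero    = [] ∷ []
perms (suc m) = concatMap (insertions (suc m)) (perms m)

des : List ℕ → ℕ
des []           = 0
des (x ∷ [])     = 0
des (x ∷ y ∷ ys) = (if y <ᵇ x then 1 else 0) ℕ.+ des (y ∷ ys)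

-- first entry σ(1) (0 for the empty list; never used for m ≥ 1)
first : List ℕ → ℕ
first []      = 0
first (x ∷ _) = x

A : ℕ → ℕ → ℕ → ℕ
A m i j = length (filter (λ σ → (first σ ℕ.≟ j)) (filter (λ σ → des σ ℕ.≟ i) (perms m)))

ℕ→ℚ : ℕ → ℚ
ℕ→ℚ n = (+ n) ℚ./ 1

ℤ→ℚ : ℤ → ℚ
ℤ→ℚ z = z ℚ./ 1

Σℚ : ∀ {n} → (Fin n → ℚ) → ℚ
Σℚ {zero}  f = 0ℚ
Σℚ {suc n} f = f F.zero ℚ.+ Σℚ (λ i → f (F.suc i))

H : (d : ℕ) → Fin (suc d) → Fin (suc d) → ℚ
H d i j = ℕ→ℚ (A (suc d) (toℕ i) (suc (toℕ j)))

_·_ : ∀ {n} → (Fin n → Fin n → ℚ) → Vector ℚ n → Vector ℚ n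
(M · v) i = Σℚ (λ j → M i j ℚ.* v j)

lincomb : ∀ {k n} → Vector ℚ k → (Fin k → Vector ℚ n) → Vector ℚ n
lincomb c b i = Σℚ (λ k → c k ℚ.* b k i)

zeroVec : ∀ {n} → Vector ℚ n
zeroVec _ = 0ℚ

IsEigenvector : ∀ {n} → (Fin n → Fin n → ℚ) → ℚ → Vector ℚ n → Set
IsEigenvector M λ′ v = (∃ λ i → v i ≢ 0ℚ) × (∀ i → (M · v) i ≡ λ′ ℚ.* v i)

IsBasis : ∀ {k n} → (Fin k → Vector ℚ n) → Set
IsBasis {k} {n} b =
  (∀ (c : Vector ℚ k) → (∀ i → lincomb c b i ≡ 0ℚ) → ∀ j → c j ≡ 0ℚ)
  × (∀ (v : Vector ℚ n) → ∃ λ (c : Vector ℚ k) → ∀ i → lincomb c b i ≡ v i)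

-- Indexing of the eigenbasis: position 0 ↦ w_1^1, position 1 ↦ w_1^2,
-- position i (2 ≤ i ≤ d) ↦ w_i.  The prescribed eigenvalue at each position:
eigval : ∀ {d} → Fin (suc d) → ℚ
eigval k with toℕ k
... | zero        = 1ℚ
... | suc zero    = 1ℚ
... | suc (suc i) = ℕ→ℚ ((suc (suc i)) !)

IsEigenbasis : (d : ℕ) → (Fin (suc d) → Vector ℚ (suc d)) → Set
IsEigenbasis d w = IsBasis w × (∀ k → IsEigenvector (H d) (eigval k) (w k))

record SimplicialComplex (n dim : ℕ) : Set where
  -- a (dim-1)-dimensional simplicial complex (dim = d)
  field
    face      : Subset n → Bool
    empty     : face ⊥ ≡ true
    closed    : ∀ σ τ → τ ⊆ σ → face σ ≡ true → face τ ≡ true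
    bounded   : ∀ σ → face σ ≡ true → ∣ σ ∣ ≤ dim
    topFace   : ∃ λ σ → face σ ≡ true × ∣ σ ∣ ≡ dim

allSubsets : (n : ℕ) → List (Subset n)
allSubsets zero    = [] ∷ []
allSubsets (suc n) = map (true ∷_) (allSubsets n) ++ map (false ∷_) (allSubsets n)

-- fvec Δ k = f_{k-1}^Δ = number of faces with k vertices
fvec : ∀ {n d} → SimplicialComplex n d → ℕ → ℕ
fvec {n} Δ k = length (filter (λ σ → SimplicialComplex.face Δ σ Data.Bool.≟ true)
                               (filter (λ σ → ∣ σ ∣ ℕ.≟ k) (allSubsets n)))
  where import Data.Bool

sgn : ℕ → ℤ
sgn zero          = + 1
sgn (suc zero)    = ℤ.- (+ 1)
sgn (suc (suc e)) = sgn e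

-- h-vector: coefficient of t^(d-i) in Σ_{k=0}^d f_{k-1} (t-1)^(d-k), i.e.
-- h_i = Σ_{k=0}^{i} (-1)^(i-k) C(d-k, i-k) f_{k-1}
hvecℤ : ∀ {n d} → SimplicialComplex n d → ℕ → ℤ
hvecℤ {d = d} Δ i =
  L.foldr ℤ._+_ (+ 0)
    (map (λ k → sgn (i ℕ.∸ k) ℤ.* (+ ((d ℕ.∸ k) C (i ℕ.∸ k))) ℤ.* (+ fvec Δ k))
         (upTo (suc i)))

hvec : ∀ {n d} → SimplicialComplex n d → Vector ℚ (suc d)
hvec Δ i = ℤ→ℚ (hvecℤ Δ (toℕ i))

replaceAt : ∀ {k n} → ℕ → Vector ℚ n → (Fin k → Vector ℚ n) → Fin k → Vector ℚ n
replaceAt p u w k with toℕ k ℕ.≟ p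
... | Relation.Nullary.yes _ = u
... | Relation.Nullary.no  _ = w k

-- Rows 0 and d of 𝔥 vanish off the diagonal (a permutation whose first entry exceeds 1 has a
-- descent, one whose first entry is at most d has an ascent), and their diagonal entries are at
-- most 1 (only the identity has no descent, only the reversal has d).  Hence an eigenvector for an
-- eigenvalue i! ≥ 2 vanishes in coordinates 0 and d, which is (ii).  Every column of 𝔥 sums to d!,
-- the number of permutations of [d+1] with a given first entry, so every eigenvector for an
-- eigenvalue other than d! has coordinate sum 0, while the coordinates of the h-vector sum to
-- f_{d-1} > 0; this forces a_d ≠ 0, which is (i).  By (ii), the unit vectors e₀ and e_d are
-- combinations of w₁¹ and w₁² up to vectors vanishing in coordinates 0 and d; those combinations
-- give (iii).  For (iv): 𝔥 is nonnegative, its row 1 and column 1 are positive away from the ends,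
-- and its column sums equal the eigenvalue d! of w_d.  Summing d!·∣w_d∣ ≤ 𝔥∣w_d∣ over all rows gives
-- equality, so in no row do the terms 𝔥_kj (w_d)_j have both signs.  Row 1 sees every interior
-- coordinate, so w_d has constant sign, and after fixing the sign positivity spreads from one
-- interior coordinate through row 1 and column 1 to all of them.

module Submission where

open import Defs

module Permutations where
  open import Data.Bool using (true; false; T)
  open import Data.Nat
  open import Data.Nat.Properties
  open import Data.Fin using (toℕ)
  open import Algebra.Properties.Semiring.Sum +-*-semiring using (sum; sum-cong-≗; sum-replicate-zero; ∑-distrib-+)
  open import Data.List using (List; []; _∷_; _++_; [_]; map; length; filter; concatMap)
  open import Data.List.Properties
    using (length-++; length-map; length-filter; ++-assoc; ++-identityʳ;
           filter-++; filter-some; filter-none; filter-all; filter-accept; filter-reject)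
  open import Data.List.Relation.Unary.All as All using (All; []; _∷_)
  import Data.List.Relation.Unary.All.Properties as All
  open import Data.List.Relation.Unary.Any using (here; there)
  open import Data.List.Membership.Propositional using (_∈_; lose)
  open import Data.List.Membership.Propositional.Properties using (∈-map⁺; ∈-concat⁺′; ∈-filter⁺)
  open import Data.Product using (_,_)
  open import Function using (_∘_)
  open import Level using (0ℓ)
  open import Relation.Nullary using (Dec; yes; no; ¬_; contradiction)
  open import Relation.Unary using (Pred; Decidable)
  open import Relation.Binary.PropositionalEquality hiding ([_])

  count : ∀ {A : Set} {P : Pred A 0ℓ} → Decidable P → List A → ℕ
  count P? = length ∘ filter P?

  -- The deciders used in the definition of A, so that A m i j is definitionally
  -- count (first≟ j) (filter (des≟ i) (perms m)).
  first≟_ : ∀ j → Decidable (λ σ → first σ ≡ j)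
  (first≟ j) σ = first σ ≟ j

  des≟_ : ∀ i → Decidable (λ σ → des σ ≡ i)
  (des≟ i) σ = des σ ≟ i

  des-desc : ∀ {a b} r → b < a → des (a ∷ b ∷ r) ≡ suc (des (b ∷ r))
  des-desc {a} {b} r b<a with b <ᵇ a | <⇒<ᵇ b<a
  ... | true | _ = refl

  des-asc : ∀ {a b} r → a ≤ b → des (a ∷ b ∷ r) ≡ des (b ∷ r)
  des-asc {a} {b} r a≤b with b <ᵇ a in eq
  ... | false = refl
  ... | true  = contradiction (<ᵇ⇒< b a (subst T (sym eq) _)) (≤⇒≯ a≤b)

  des-∷-≥ : ∀ y τ → des τ ≤ des (y ∷ τ)
  des-∷-≥ y []      = z≤n
  des-∷-≥ y (b ∷ r) with b <ᵇ y
  ... | true  = n≤1+n _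
  ... | false = ≤-refl

  des-∷-≤ : ∀ y τ → des (y ∷ τ) ≤ suc (des τ)
  des-∷-≤ y []      = z≤n
  des-∷-≤ y (b ∷ r) with b <ᵇ y
  ... | true  = ≤-refl
  ... | false = n≤1+n _

  des<length : ∀ y τ → des (y ∷ τ) < length (y ∷ τ)
  des<length y []      = s≤s z≤n
  des<length y (b ∷ r) = ≤-trans (s≤s (des-∷-≤ y (b ∷ r))) (s≤s (des<length b r))

  below-first⇒descent : ∀ {y} σ → y ∈ σ → y < first σ → 0 < des σ
  below-first⇒descent (a ∷ r)     (here refl) y<a = contradiction y<a (<-irrefl refl)
  below-first⇒descent (a ∷ b ∷ r) (there y∈)  y<a with b <? a
  ... | yes b<a rewrite des-desc r b<a = s≤s z≤n
  ... | no  b≮a rewrite des-asc r (≮⇒≥ b≮a) =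
    below-first⇒descent (b ∷ r) y∈ (<-≤-trans y<a (≮⇒≥ b≮a))

  above-first⇒ascent : ∀ {y} σ → y ∈ σ → first σ < y → suc (des σ) < length σ
  above-first⇒ascent (a ∷ r)     (here refl) a<y = contradiction a<y (<-irrefl refl)
  above-first⇒ascent (a ∷ b ∷ r) (there y∈)  a<y with a <? b
  ... | yes a<b rewrite des-asc r (<⇒≤ a<b) = s≤s (des<length b r)
  ... | no  a≮b =
    ≤-trans (s≤s (s≤s (des-∷-≤ a (b ∷ r))))
            (s≤s (above-first⇒ascent (b ∷ r) y∈ (≤-<-trans (≮⇒≥ a≮b) a<y)))

  All-concatMap⁺ : ∀ {P Q : Pred (List ℕ) 0ℓ} (g : List ℕ → List (List ℕ)) {L} →
                   (∀ {σ} → P σ → All Q (g σ)) → All P L → All Q (concatMap g L)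
  All-concatMap⁺ g h = All.concat⁺ ∘ All.map⁺ ∘ All.map h

  insertions-length : ∀ x σ → All (λ τ → length τ ≡ suc (length σ)) (insertions x σ)
  insertions-length x []       = refl ∷ []
  insertions-length x (y ∷ ys) = refl ∷ All.map⁺ (All.map (cong suc) (insertions-length x ys))

  length-insertions : ∀ x σ → length (insertions x σ) ≡ suc (length σ)
  length-insertions x []       = refl
  length-insertions x (y ∷ ys) = cong suc (trans (length-map (y ∷_) (insertions x ys)) (length-insertions x ys))

  insertions-All : ∀ {P : Pred ℕ 0ℓ} x σ → P x → All P σ → All (All P) (insertions x σ)
  insertions-All x []       px []         = (px ∷ []) ∷ []
  insertions-All x (y ∷ ys) px (py ∷ pys) =
    (px ∷ py ∷ pys) ∷ All.map⁺ (All.map (py ∷_) (insertions-All x ys px pys))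

  insertions-∋ : ∀ {y} x σ → y ∈ σ → All (y ∈_) (insertions x σ)
  insertions-∋ x (z ∷ zs) (here refl) = there (here refl) ∷ All.map⁺ (All.tabulate (λ _ → here refl))
  insertions-∋ x (z ∷ zs) (there y∈)  = there (there y∈) ∷ All.map⁺ (All.map there (insertions-∋ x zs y∈))

  insertions-∋new : ∀ x σ → All (x ∈_) (insertions x σ)
  insertions-∋new x []       = here refl ∷ []
  insertions-∋new x (y ∷ ys) = here refl ∷ All.map⁺ (All.map there (insertions-∋new x ys))

  ∈-insertions : ∀ x P Q → P ++ x ∷ Q ∈ insertions x (P ++ Q)
  ∈-insertions x []      []      = here refl
  ∈-insertions x []      (q ∷ Q) = here refl
  ∈-insertions x (p ∷ P) Q       = there (∈-map⁺ (p ∷_) (∈-insertions x P Q))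

  perms-length : ∀ m → All (λ σ → length σ ≡ m) (perms m)
  perms-length zero    = refl ∷ []
  perms-length (suc m) = All-concatMap⁺ (insertions (suc m))
    (λ {σ} eq → All.map (λ e → trans e (cong suc eq)) (insertions-length (suc m) σ)) (perms-length m)

  perms-bounded : ∀ m → All (All (_≤ m)) (perms m)
  perms-bounded zero    = [] ∷ []
  perms-bounded (suc m) = All-concatMap⁺ (insertions (suc m))
    (λ {σ} σ≤m → insertions-All (suc m) σ ≤-refl (All.map m≤n⇒m≤1+n σ≤m)) (perms-bounded m)

  perms-∋1 : ∀ m → All (1 ∈_) (perms (suc m))
  perms-∋1 zero    = here refl ∷ []
  perms-∋1 (suc m) = All-concatMap⁺ (insertions (suc (suc m))) (insertions-∋ (suc (suc m)) _) (perms-∋1 m)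

  perms-∋max : ∀ m → All (suc m ∈_) (perms (suc m))
  perms-∋max m = All-concatMap⁺ (insertions (suc m)) (λ {σ} _ → insertions-∋new (suc m) σ) (perms-length m)

  ∈-perms-insert : ∀ n P Q → P ++ Q ∈ perms n → P ++ suc n ∷ Q ∈ perms (suc n)
  ∈-perms-insert n P Q σ∈ = ∈-concat⁺′ (∈-insertions (suc n) P Q) (∈-map⁺ (insertions (suc n)) σ∈)

  module _ {A : Set} {P : Pred A 0ℓ} (P? : Decidable P) where

    count-++ : ∀ xs ys → count P? (xs ++ ys) ≡ count P? xs + count P? ys
    count-++ xs ys = trans (cong length (filter-++ P? xs ys)) (length-++ (filter P? xs))

    count-singleton-accept : ∀ x → P x → count P? [ x ] ≡ 1
    count-singleton-accept x px with P? x
    ... | yes _  = refl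
    ... | no ¬px = contradiction px ¬px

    count-singleton-reject : ∀ x → ¬ P x → count P? [ x ] ≡ 0
    count-singleton-reject x ¬px with P? x
    ... | yes px = contradiction px ¬px
    ... | no _   = refl

  module _ {P Q : Pred (List ℕ) 0ℓ} (P? : Decidable P) (Q? : Decidable Q) (g : List ℕ → List (List ℕ)) where

    count-concatMap-≤ : ∀ {L} → All (λ σ → count P? (g σ) ≤ count Q? [ σ ]) L →
                        count P? (concatMap g L) ≤ count Q? L
    count-concatMap-≤ {[]}    []       = z≤n
    count-concatMap-≤ {σ ∷ L} (h ∷ hs) = begin
      count P? (g σ ++ concatMap g L)       ≡⟨ count-++ P? (g σ) _ ⟩
      count P? (g σ) + count P? (concatMap g L) ≤⟨ +-mono-≤ h (count-concatMap-≤ hs) ⟩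
      count Q? [ σ ] + count Q? L           ≡⟨ count-++ Q? [ σ ] L ⟨
      count Q? (σ ∷ L)                      ∎
      where open ≤-Reasoning

    count-concatMap-* : ∀ {L k} → All (λ σ → count P? (g σ) ≡ count Q? [ σ ] * k) L →
                        count P? (concatMap g L) ≡ count Q? L * k
    count-concatMap-* {[]}        []       = refl
    count-concatMap-* {σ ∷ L} {k} (h ∷ hs) = begin
      count P? (g σ ++ concatMap g L)            ≡⟨ count-++ P? (g σ) _ ⟩
      count P? (g σ) + count P? (concatMap g L)  ≡⟨ cong₂ _+_ h (count-concatMap-* hs) ⟩
      count Q? [ σ ] * k + count Q? L * k        ≡⟨ *-distribʳ-+ k (count Q? [ σ ]) _ ⟨
      (count Q? [ σ ] + count Q? L) * k          ≡⟨ cong (_* k) (count-++ Q? [ σ ] L) ⟨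
      count Q? (σ ∷ L) * k                       ∎
      where open ≡-Reasoning

    count-concatMap-const : ∀ {L k} → All (λ σ → count P? (g σ) ≡ k) L →
                            count P? (concatMap g L) ≡ length L * k
    count-concatMap-const {[]}    []       = refl
    count-concatMap-const {σ ∷ L} (h ∷ hs) =
      trans (count-++ P? (g σ) _) (cong₂ _+_ h (count-concatMap-const hs))

  length-concatMap-const : ∀ (g : List ℕ → List (List ℕ)) {L k} → All (λ σ → length (g σ) ≡ k) L →
                           length (concatMap g L) ≡ length L * k
  length-concatMap-const g {[]}    []       = refl
  length-concatMap-const g {σ ∷ L} (h ∷ hs) =
    trans (length-++ (g σ)) (cong₂ _+_ h (length-concatMap-const g hs))

  length-perms : ∀ m → length (perms m) ≡ m !
  length-perms zero    = refl
  length-perms (suc m) = begin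
    length (perms (suc m))         ≡⟨ length-concatMap-const (insertions (suc m))
                                        (All.map (λ {σ} eq → trans (length-insertions (suc m) σ) (cong suc eq)) (perms-length m)) ⟩
    length (perms m) * suc m       ≡⟨ cong (_* suc m) (length-perms m) ⟩
    m ! * suc m                    ≡⟨ *-comm (m !) (suc m) ⟩
    suc m !                        ∎
    where open ≡-Reasoning

  first-map-∷ : ∀ y L → All (λ τ → first τ ≡ y) (map (y ∷_) L)
  first-map-∷ y L = All.map⁺ (All.tabulate {xs = L} (λ _ → refl))

  count-first-insertions-new : ∀ x σ → All (_< x) σ → count (first≟ x) (insertions x σ) ≡ 1
  count-first-insertions-new x []       []         = count-singleton-accept (first≟ x) [ x ] refl
  count-first-insertions-new x (y ∷ ys) (y<x ∷ _) = begin
    count (first≟ x) (insertions x (y ∷ ys))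
      ≡⟨ count-++ (first≟ x) [ x ∷ y ∷ ys ] _ ⟩
    count (first≟ x) [ x ∷ y ∷ ys ] + count (first≟ x) (map (y ∷_) (insertions x ys))
      ≡⟨ cong₂ _+_ (count-singleton-accept (first≟ x) (x ∷ y ∷ ys) refl)
                   (cong length (filter-none (first≟ x) (All.map (λ { refl → <⇒≢ y<x }) (first-map-∷ y (insertions x ys))))) ⟩
    1 + 0 ∎
    where open ≡-Reasoning

  count-first-insertions-old : ∀ {f} x y ys → x ≢ f →
    count (first≟ f) (insertions x (y ∷ ys)) ≡ count (first≟ f) [ y ∷ ys ] * suc (length ys)
  count-first-insertions-old {f} x y ys x≢f = begin
    count (first≟ f) (insertions x (y ∷ ys))
      ≡⟨ count-++ (first≟ f) [ x ∷ y ∷ ys ] _ ⟩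
    count (first≟ f) [ x ∷ y ∷ ys ] + count (first≟ f) later
      ≡⟨ cong (_+ count (first≟ f) later) (count-singleton-reject (first≟ f) (x ∷ y ∷ ys) x≢f) ⟩
    count (first≟ f) later
      ≡⟨ count-later (y ≟ f) ⟩
    count (first≟ f) [ y ∷ ys ] * suc (length ys) ∎
    where
    open ≡-Reasoning
    later = map (y ∷_) (insertions x ys)
    later-first : All (λ τ → first τ ≡ y) later
    later-first = first-map-∷ y (insertions x ys)
    length-later : length later ≡ suc (length ys)
    length-later = trans (length-map (y ∷_) (insertions x ys)) (length-insertions x ys)
    count-later : Dec (y ≡ f) → count (first≟ f) later ≡ count (first≟ f) [ y ∷ ys ] * suc (length ys)
    count-later (yes y≡f) = begin
      count (first≟ f) later ≡⟨ cong length (filter-all (first≟ f) (All.map (λ { refl → y≡f }) later-first)) ⟩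
      length later           ≡⟨ length-later ⟩
      suc (length ys)        ≡⟨ +-identityʳ _ ⟨
      1 * suc (length ys)    ≡⟨ cong (_* suc (length ys)) (count-singleton-accept (first≟ f) (y ∷ ys) y≡f) ⟨
      count (first≟ f) [ y ∷ ys ] * suc (length ys) ∎
    count-later (no y≢f) = begin
      count (first≟ f) later ≡⟨ cong length (filter-none (first≟ f) (All.map (λ { refl → y≢f }) later-first)) ⟩
      0                      ≡⟨ cong (_* suc (length ys)) (count-singleton-reject (first≟ f) (y ∷ ys) y≢f) ⟨
      count (first≟ f) [ y ∷ ys ] * suc (length ys) ∎

  count-first-perms : ∀ m f → 1 ≤ f → f ≤ suc m → count (first≟ f) (perms (suc m)) ≡ m !
  count-first-perms zero f 1≤f f≤1 rewrite ≤-antisym f≤1 1≤f = refl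
  count-first-perms (suc m) f 1≤f f≤ with f ≟ suc (suc m)
  ... | yes refl = begin
    count (first≟ x) (perms x)   ≡⟨ count-concatMap-const (first≟ x) (first≟ x) (insertions x)
                                      (All.map (λ {σ} σ≤ → count-first-insertions-new x σ (All.map s≤s σ≤))
                                               (perms-bounded (suc m))) ⟩
    length (perms (suc m)) * 1   ≡⟨ *-identityʳ _ ⟩
    length (perms (suc m))       ≡⟨ length-perms (suc m) ⟩
    suc m !                      ∎
    where open ≡-Reasoning
          x = suc (suc m)
  ... | no f≢x = begin
    count (first≟ f) (perms x)                 ≡⟨ count-concatMap-* (first≟ f) (first≟ f) (insertions x)
                                                    (All.map (λ {σ} → per-perm σ) (perms-length (suc m))) ⟩
    count (first≟ f) (perms (suc m)) * suc m   ≡⟨ cong (_* suc m) (count-first-perms m f 1≤f f<x) ⟩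
    m ! * suc m                                ≡⟨ *-comm (m !) (suc m) ⟩
    suc m !                                    ∎
    where
    open ≡-Reasoning
    x = suc (suc m)
    f<x = ≤-pred (≤∧≢⇒< f≤ f≢x)
    per-perm : ∀ σ → length σ ≡ suc m → count (first≟ f) (insertions x σ) ≡ count (first≟ f) [ σ ] * suc m
    per-perm (y ∷ ys) refl = count-first-insertions-old x y ys (f≢x ∘ sym)

  sum-indicator : ∀ {D} (t : ℕ → ℕ) e → e ≤ D → (∀ k → k ≢ e → t k ≡ 0) → sum {suc D} (t ∘ toℕ) ≡ t e
  sum-indicator {D} t zero _ t≡0 = begin
    t 0 + sum {D} (λ i → t (suc (toℕ i))) ≡⟨ cong (t 0 +_) (sum-cong-≗ {D} (λ i → t≡0 (suc (toℕ i)) λ ())) ⟩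
    t 0 + sum {D} (λ _ → 0)               ≡⟨ cong (t 0 +_) (sum-replicate-zero D) ⟩
    t 0 + 0                               ≡⟨ +-identityʳ (t 0) ⟩
    t 0                                   ∎
    where open ≡-Reasoning
  sum-indicator {suc D} t (suc e) (s≤s e≤D) t≡0 = begin
    t 0 + sum {suc D} (λ i → t (suc (toℕ i))) ≡⟨ cong (_+ sum {suc D} (λ i → t (suc (toℕ i)))) (t≡0 0 λ ()) ⟩
    sum {suc D} (λ i → t (suc (toℕ i)))       ≡⟨ sum-indicator (t ∘ suc) e e≤D (λ k → t≡0 (suc k) ∘ (_∘ suc-injective)) ⟩
    t (suc e)                                 ∎
    where open ≡-Reasoning

  count-by-des : ∀ {Q : Pred (List ℕ) 0ℓ} (Q? : Decidable Q) D L → All (λ σ → des σ ≤ D) L →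
                 sum {suc D} (λ i → count Q? (filter (des≟ toℕ i) L)) ≡ count Q? L
  count-by-des Q? D []      []            = sum-replicate-zero (suc D)
  count-by-des Q? D (σ ∷ L) (des≤D ∷ des≤D′) = begin
    sum {suc D} (λ i → count Q? (filter (des≟ toℕ i) (σ ∷ L)))
      ≡⟨ sum-cong-≗ {suc D} (λ i → trans (cong (count Q?) (filter-++ (des≟ toℕ i) [ σ ] L))
                                         (count-++ Q? (filter (des≟ toℕ i) [ σ ]) _)) ⟩
    sum {suc D} (λ i → count Q? (filter (des≟ toℕ i) [ σ ]) + count Q? (filter (des≟ toℕ i) L))
      ≡⟨ ∑-distrib-+ {suc D} (λ i → count Q? (filter (des≟ toℕ i) [ σ ])) (λ i → count Q? (filter (des≟ toℕ i) L)) ⟩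
    sum {suc D} (λ i → count Q? (filter (des≟ toℕ i) [ σ ])) + sum {suc D} (λ i → count Q? (filter (des≟ toℕ i) L))
      ≡⟨ cong₂ _+_ (sum-indicator (λ k → count Q? (filter (des≟ k) [ σ ])) (des σ) des≤D only-des-σ)
                   (count-by-des Q? D L des≤D′) ⟩
    count Q? (filter (des≟ des σ) [ σ ]) + count Q? L
      ≡⟨ cong (λ τs → count Q? τs + count Q? L) (filter-accept (des≟ des σ) {x = σ} {xs = []} refl) ⟩
    count Q? [ σ ] + count Q? L
      ≡⟨ count-++ Q? [ σ ] L ⟨
    count Q? (σ ∷ L) ∎
    where
    open ≡-Reasoning
    only-des-σ : ∀ k → k ≢ des σ → count Q? (filter (des≟ k) [ σ ]) ≡ 0
    only-des-σ k k≢ = cong (count Q?) (filter-reject (des≟ k) {x = σ} {xs = []} (k≢ ∘ sym))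

  perms-des≤ : ∀ d → All (λ σ → des σ ≤ d) (perms (suc d))
  perms-des≤ d = All.map (λ {σ} → bound σ) (perms-length (suc d))
    where
    bound : ∀ σ → length σ ≡ suc d → des σ ≤ d
    bound (y ∷ ys) refl = ≤-pred (des<length y ys)

  A-column-sum : ∀ d f → 1 ≤ f → f ≤ suc d → sum {suc d} (λ i → A (suc d) (toℕ i) f) ≡ d !
  A-column-sum d f 1≤f f≤ = trans (count-by-des (first≟ f) d (perms (suc d)) (perms-des≤ d))
                                  (count-first-perms d f 1≤f f≤)

  module _ {P Q : Pred (List ℕ) 0ℓ} (P? : Decidable P) (Q? : Decidable Q) where

    count-filter-none : ∀ {L} → All (λ σ → Q σ → ¬ P σ) L → count P? (filter Q? L) ≡ 0
    count-filter-none {L} h =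
      cong length (filter-none P? (All.zipWith (λ (q , q⇒¬p) → q⇒¬p q) (All.all-filter Q? L , All.filter⁺ Q? h)))

    count-map-≤ : ∀ (f : List ℕ → List ℕ) L → (∀ τ → P (f τ) → Q τ) → count P? (map f L) ≤ count Q? L
    count-map-≤ f []      h = z≤n
    count-map-≤ f (τ ∷ L) h with P? (f τ) | Q? τ
    ... | yes p | yes _ = s≤s (count-map-≤ f L h)
    ... | yes p | no ¬q = contradiction (h τ p) ¬q
    ... | no _  | yes _ = m≤n⇒m≤1+n (count-map-≤ f L h)
    ... | no _  | no _  = count-map-≤ f L h

  A-row₀-off : ∀ m f → 2 ≤ f → A (suc m) 0 f ≡ 0
  A-row₀-off m f 2≤f = count-filter-none (first≟ f) (des≟ 0) (All.map (λ {σ} → no-descent σ) (perms-∋1 m))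
    where
    no-descent : ∀ σ → 1 ∈ σ → des σ ≡ 0 → first σ ≢ f
    no-descent σ 1∈σ des≡0 refl = contradiction (subst (0 <_) des≡0 (below-first⇒descent σ 1∈σ 2≤f)) (<-irrefl refl)

  A-row-max-off : ∀ d f → f ≤ d → A (suc d) d f ≡ 0
  A-row-max-off d f f≤d = count-filter-none (first≟ f) (des≟ d)
    (All.zipWith (λ {σ} (d+1∈σ , len) → no-ascent σ d+1∈σ len) (perms-∋max d , perms-length (suc d)))
    where
    no-ascent : ∀ σ → suc d ∈ σ → length σ ≡ suc d → des σ ≡ d → first σ ≢ f
    no-ascent σ d+1∈σ len des≡d refl =
      contradiction (subst₂ (λ a b → suc a < b) des≡d len (above-first⇒ascent σ d+1∈σ (s≤s f≤d))) (<-irrefl refl)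

  insertions-des-∷-≥ : ∀ x σ {y} → y < x → All (_< x) σ → All (λ τ → des (y ∷ σ) ≤ des (y ∷ τ)) (insertions x σ)
  insertions-des-∷-≥ x []       y<x []             = z≤n ∷ []
  insertions-des-∷-≥ x (z ∷ zs) {y} y<x (z<x ∷ zs<x) =
    new-second ∷ All.map⁺ (All.map (+-monoʳ-≤ _) (insertions-des-∷-≥ x zs z<x zs<x))
    where
    new-second : des (y ∷ z ∷ zs) ≤ des (y ∷ x ∷ z ∷ zs)
    new-second rewrite des-asc (z ∷ zs) (<⇒≤ y<x) | des-desc zs z<x = des-∷-≤ y (z ∷ zs)

  insertions-des-≥ : ∀ x σ → All (_< x) σ → All (λ τ → des σ ≤ des τ) (insertions x σ)
  insertions-des-≥ x []       _              = z≤n ∷ []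
  insertions-des-≥ x (z ∷ zs) (z<x ∷ zs<x) = des-∷-≥ x (z ∷ zs) ∷ All.map⁺ (insertions-des-∷-≥ x zs z<x zs<x)

  count-des≡0-insertions-≤1 : ∀ x σ → All (_< x) σ → count (des≟ 0) (insertions x σ) ≤ 1
  count-des≡0-insertions-≤1 x []       []            = ≤-refl
  count-des≡0-insertions-≤1 x (y ∷ ys) (y<x ∷ ys<x) = begin
    count (des≟ 0) (insertions x (y ∷ ys))
      ≡⟨ count-++ (des≟ 0) [ x ∷ y ∷ ys ] _ ⟩
    count (des≟ 0) [ x ∷ y ∷ ys ] + count (des≟ 0) (map (y ∷_) (insertions x ys))
      ≡⟨ cong (_+ count (des≟ 0) (map (y ∷_) (insertions x ys)))
              (count-singleton-reject (des≟ 0) (x ∷ y ∷ ys) (subst (_≢ 0) (sym (des-desc ys y<x)) λ ())) ⟩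
    count (des≟ 0) (map (y ∷_) (insertions x ys))
      ≤⟨ count-map-≤ (des≟ 0) (des≟ 0) (y ∷_) (insertions x ys)
                     (λ τ des≡0 → n≤0⇒n≡0 (subst (des τ ≤_) des≡0 (des-∷-≥ y τ))) ⟩
    count (des≟ 0) (insertions x ys)
      ≤⟨ count-des≡0-insertions-≤1 x ys ys<x ⟩
    1 ∎
    where open ≤-Reasoning

  count-des≡0-insertions : ∀ x σ → All (_< x) σ → count (des≟ 0) (insertions x σ) ≤ count (des≟ 0) [ σ ]
  count-des≡0-insertions x σ σ<x with des σ ≟ 0
  ... | yes des≡0 = subst (count (des≟ 0) (insertions x σ) ≤_) (sym (count-singleton-accept (des≟ 0) σ des≡0))
                          (count-des≡0-insertions-≤1 x σ σ<x)
  ... | no des≢0  = ≤-reflexive (trans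
    (cong length (filter-none (des≟ 0) {xs = insertions x σ} (All.map (λ {τ} → positive {τ}) (insertions-des-≥ x σ σ<x))))
    (sym (count-singleton-reject (des≟ 0) σ des≢0)))
    where
    positive : ∀ {τ} → des σ ≤ des τ → des τ ≢ 0
    positive le des≡0 = des≢0 (n≤0⇒n≡0 (subst (des σ ≤_) des≡0 le))

  count-des≡0-perms : ∀ m → count (des≟ 0) (perms m) ≤ 1
  count-des≡0-perms zero    = ≤-refl
  count-des≡0-perms (suc m) = ≤-trans
    (count-concatMap-≤ (des≟ 0) (des≟ 0) (insertions (suc m))
      (All.map (λ {σ} σ≤m → count-des≡0-insertions (suc m) σ (All.map s≤s σ≤m)) (perms-bounded m)))
    (count-des≡0-perms m)

  A-row₀-diag≤1 : ∀ m → A m 0 1 ≤ 1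
  A-row₀-diag≤1 m = ≤-trans (length-filter (first≟ 1) (filter (des≟ 0) (perms m))) (count-des≡0-perms m)

  count-des-suc : ∀ d σ τ → des τ ≡ suc (des σ) → count (des≟ suc d) [ τ ] ≡ count (des≟ d) [ σ ]
  count-des-suc d σ τ des-τ with des σ ≟ d
  ... | yes refl = trans (count-singleton-accept (des≟ suc d) τ des-τ) (sym (count-singleton-accept (des≟ d) σ refl))
  ... | no  ≢d   = trans (count-singleton-reject (des≟ suc d) τ (≢d ∘ suc-injective ∘ trans (sym des-τ)))
                         (sym (count-singleton-reject (des≟ d) σ ≢d))

  count-des-max-insertions : ∀ x d σ → All (_< x) σ → length σ ≡ suc d →
                             count (des≟ suc d) (insertions x σ) ≤ count (des≟ d) [ σ ]
  count-des-max-insertions x d (y ∷ ys) (y<x ∷ _) len = ≤-reflexive (begin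
    count (des≟ suc d) (insertions x (y ∷ ys))
      ≡⟨ count-++ (des≟ suc d) [ x ∷ y ∷ ys ] _ ⟩
    count (des≟ suc d) [ x ∷ y ∷ ys ] + count (des≟ suc d) (map (y ∷_) (insertions x ys))
      ≡⟨ cong₂ _+_ (count-des-suc d (y ∷ ys) (x ∷ y ∷ ys) (des-desc ys y<x))
                   (cong length (filter-none (des≟ suc d)
                     (All.map⁺ (All.zipWith (λ {τ} (x∈τ , len-τ) → too-short τ x∈τ len-τ)
                                            (insertions-∋new x ys , insertions-length x ys))))) ⟩
    count (des≟ d) [ y ∷ ys ] + 0
      ≡⟨ +-identityʳ _ ⟩
    count (des≟ d) [ y ∷ ys ] ∎)
    where
    open ≡-Reasoning
    too-short : ∀ τ → x ∈ τ → length τ ≡ suc (length ys) → des (y ∷ τ) ≢ suc d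
    too-short τ x∈τ len-τ des≡ = contradiction
      (subst₂ (λ a b → suc a < b) des≡ (cong suc (trans len-τ len)) (above-first⇒ascent (y ∷ τ) (there x∈τ) y<x))
      (<-irrefl refl)

  count-des-max-perms : ∀ d → count (des≟ d) (perms (suc d)) ≤ 1
  count-des-max-perms zero    = ≤-refl
  count-des-max-perms (suc d) = ≤-trans
    (count-concatMap-≤ (des≟ suc d) (des≟ d) (insertions (suc (suc d)))
      (All.zipWith (λ {σ} (σ≤ , len) → count-des-max-insertions (suc (suc d)) d σ (All.map s≤s σ≤) len)
                   (perms-bounded (suc d) , perms-length (suc d))))
    (count-des-max-perms d)

  A-row-max-diag≤1 : ∀ d → A (suc d) d (suc d) ≤ 1
  A-row-max-diag≤1 d = ≤-trans (length-filter (first≟ suc d) (filter (des≟ d) (perms (suc d)))) (count-des-max-perms d)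

  ascending : ℕ → ℕ → List ℕ
  ascending a zero    = []
  ascending a (suc n) = suc a ∷ ascending (suc a) n

  descending : ℕ → ℕ → List ℕ
  descending a zero    = []
  descending a (suc l) = suc (a + l) ∷ descending a l

  perms-++-ascending : ∀ a n σ → σ ∈ perms a → σ ++ ascending a n ∈ perms (a + n)
  perms-++-ascending a zero    σ σ∈ = subst₂ (λ τ k → τ ∈ perms k) (sym (++-identityʳ σ)) (sym (+-identityʳ a)) σ∈
  perms-++-ascending a (suc n) σ σ∈ = subst₂ (λ τ k → τ ∈ perms k) (++-assoc σ [ suc a ] _) (sym (+-suc a n))
    (perms-++-ascending (suc a) n (σ ++ [ suc a ])
      (∈-perms-insert a σ [] (subst (_∈ perms a) (sym (++-identityʳ σ)) σ∈)))

  perms-++-descending : ∀ a l σ → σ ∈ perms a → σ ++ descending a l ∈ perms (a + l)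
  perms-++-descending a zero    σ σ∈ = subst₂ (λ τ k → τ ∈ perms k) (sym (++-identityʳ σ)) (sym (+-identityʳ a)) σ∈
  perms-++-descending a (suc l) σ σ∈ = subst (λ k → σ ++ descending a (suc l) ∈ perms k) (sym (+-suc a l))
    (∈-perms-insert (a + l) σ (descending a l) (perms-++-descending a l σ σ∈))

  des-∷-ascending : ∀ {y a} n → y ≤ a → des (y ∷ ascending a n) ≡ 0
  des-∷-ascending zero    _   = refl
  des-∷-ascending {a = a} (suc n) y≤a = trans (des-asc (ascending (suc a) n) (m≤n⇒m≤1+n y≤a)) (des-∷-ascending n ≤-refl)

  des-descending : ∀ k l → des (descending k (suc l)) ≡ l
  des-descending k zero    = refl
  des-descending k (suc l) = trans (des-desc (descending k l) (≤-reflexive (sym (cong suc (+-suc k l))))) (cong suc (des-descending k l))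

  des-ascending-ascending : ∀ {y a b} n l → y ≤ a → a + n ≤ b → des (y ∷ ascending a n ++ ascending b l) ≡ 0
  des-ascending-ascending {a = a} zero    l y≤a a+0≤b = des-∷-ascending l (≤-trans y≤a (subst (_≤ _) (+-identityʳ a) a+0≤b))
  des-ascending-ascending {a = a} {b} (suc n) l y≤a a+n≤b =
    trans (des-asc (ascending (suc a) n ++ ascending b l) (m≤n⇒m≤1+n y≤a))
          (des-ascending-ascending n l ≤-refl (subst (_≤ b) (+-suc a n) a+n≤b))

  des-ascending-descending : ∀ {y a k} n l → y ≤ a → a + n ≤ k → des (y ∷ ascending a n ++ descending k (suc l)) ≡ l
  des-ascending-descending {a = a} {k} zero l y≤a a+0≤k =
    trans (des-asc (descending k l) (≤-trans y≤a (≤-trans (subst (_≤ k) (+-identityʳ a) a+0≤k) (m≤n⇒m≤1+n (m≤m+n k l)))))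
          (des-descending k l)
  des-ascending-descending {a = a} {k} (suc n) l y≤a a+n≤k =
    trans (des-asc (ascending (suc a) n ++ descending k (suc l)) (m≤n⇒m≤1+n y≤a))
          (des-ascending-descending n l ≤-refl (subst (_≤ k) (+-suc a n) a+n≤k))

  A-positive : ∀ {m i f} σ → σ ∈ perms m → des σ ≡ i → first σ ≡ f → 0 < A m i f
  A-positive {i = i} {f} σ σ∈ des≡i first≡f =
    filter-some (first≟ f) (lose (∈-filter⁺ (des≟ i) σ∈ des≡i) first≡f)

  A-row₁-pos : ∀ m f → 2 ≤ f → f ≤ m → 0 < A m 1 f
  A-row₁-pos m f@(suc (suc g)) (s≤s (s≤s z≤n)) f≤m with m≤n⇒∃[o]m+o≡n f≤m
  ... | n , refl = A-positive {f + n} σ σ∈ des≡1 refl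
    where
    σ = f ∷ ascending 0 (suc g) ++ ascending f n
    σ∈ : σ ∈ perms (f + n)
    σ∈ = perms-++-ascending f n (f ∷ ascending 0 (suc g))
           (∈-perms-insert (suc g) [] (ascending 0 (suc g)) (perms-++-ascending 0 (suc g) [] (here refl)))
    des≡1 : des σ ≡ 1
    des≡1 = trans (des-desc {f} {1} (ascending 1 g ++ ascending f n) (s≤s (s≤s z≤n)))
                  (cong suc (des-ascending-ascending {1} {1} {f} g n ≤-refl (n≤1+n (suc g))))

  A-column₂-pos : ∀ m i → 1 ≤ i → i + 2 ≤ m → 0 < A m i 2
  A-column₂-pos m (suc l) (s≤s z≤n) i+2≤m with m≤n⇒∃[o]m+o≡n i+2≤m
  ... | n , refl = subst (λ k → 0 < A k (suc l) 2) size (A-positive {2 + n + suc l} σ σ∈ des≡i refl)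
    where
    σ = 2 ∷ 1 ∷ ascending 2 n ++ descending (2 + n) (suc l)
    σ∈ : σ ∈ perms (2 + n + suc l)
    σ∈ = perms-++-descending (2 + n) (suc l) (2 ∷ 1 ∷ ascending 2 n) (perms-++-ascending 2 n (2 ∷ 1 ∷ []) (here refl))
    des≡i : des σ ≡ suc l
    des≡i = trans (des-desc {2} {1} (ascending 2 n ++ descending (2 + n) (suc l)) (s≤s (s≤s z≤n)))
                  (cong suc (des-ascending-descending {1} {2} {2 + n} n l (s≤s z≤n) ≤-refl))
    size : 2 + n + suc l ≡ suc l + 2 + n
    size = trans (+-comm (2 + n) (suc l)) (sym (+-assoc (suc l) 2 n))

module HVector where
  open import Data.Nat as ℕ using (ℕ; zero; suc; _∸_; z≤n; s≤s)
  import Data.Nat.Properties as ℕ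
  open import Data.Nat.Combinatorics using (_C_; nCk+nC[k+1]≡[n+1]C[k+1]; k>n⇒nCk≡0)
  open import Data.Integer using (ℤ; +_; _+_; _*_; -_)
  open import Data.Integer.Properties
  open import Data.Integer.Tactic.RingSolver using (solve-∀)
  open import Algebra.Properties.CommutativeSemigroup +-commutativeSemigroup using (interchange)
  open import Data.List using (map; upTo; applyUpTo; foldr)
  open import Data.List.Properties using (map-applyUpTo)
  open import Relation.Nullary using (contradiction)
  open import Relation.Binary.PropositionalEquality

  ∑ℤ : ℕ → (ℕ → ℤ) → ℤ
  ∑ℤ zero    g = + 0
  ∑ℤ (suc n) g = g 0 + ∑ℤ n (λ k → g (suc k))

  ∑ℤ-cong : ∀ n {f g : ℕ → ℤ} → (∀ k → k ℕ.< n → f k ≡ g k) → ∑ℤ n f ≡ ∑ℤ n g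
  ∑ℤ-cong zero    f≡g = refl
  ∑ℤ-cong (suc n) f≡g = cong₂ _+_ (f≡g 0 (s≤s z≤n)) (∑ℤ-cong n (λ k k<n → f≡g (suc k) (s≤s k<n)))

  ∑ℤ-zero : ∀ n (g : ℕ → ℤ) → (∀ k → k ℕ.< n → g k ≡ + 0) → ∑ℤ n g ≡ + 0
  ∑ℤ-zero zero    g g≡0 = refl
  ∑ℤ-zero (suc n) g g≡0 =
    cong₂ _+_ (g≡0 0 (s≤s z≤n)) (∑ℤ-zero n (λ k → g (suc k)) (λ k k<n → g≡0 (suc k) (s≤s k<n)))

  ∑ℤ-last : ∀ n (g : ℕ → ℤ) → ∑ℤ (suc n) g ≡ ∑ℤ n g + g n
  ∑ℤ-last zero    g = trans (+-identityʳ (g 0)) (sym (+-identityˡ (g 0)))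
  ∑ℤ-last (suc n) g = trans (cong (_+_ (g 0)) (∑ℤ-last n (λ k → g (suc k)))) (sym (+-assoc (g 0) _ _))

  ∑ℤ-distrib-+ : ∀ n (f g : ℕ → ℤ) → ∑ℤ n (λ k → f k + g k) ≡ ∑ℤ n f + ∑ℤ n g
  ∑ℤ-distrib-+ zero    f g = refl
  ∑ℤ-distrib-+ (suc n) f g rewrite ∑ℤ-distrib-+ n (λ k → f (suc k)) (λ k → g (suc k)) =
    interchange (f 0) (g 0) (∑ℤ n (λ k → f (suc k))) (∑ℤ n (λ k → g (suc k)))

  ∑ℤ-distribʳ : ∀ n (f : ℕ → ℤ) c → ∑ℤ n (λ k → f k * c) ≡ ∑ℤ n f * c
  ∑ℤ-distribʳ zero    f c = sym (*-zeroˡ c)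
  ∑ℤ-distribʳ (suc n) f c = trans (cong (_+_ (f 0 * c)) (∑ℤ-distribʳ n (λ k → f (suc k)) c)) (sym (*-distribʳ-+ c (f 0) _))

  foldr-map-upTo : ∀ n (g : ℕ → ℤ) → foldr _+_ (+ 0) (map g (upTo n)) ≡ ∑ℤ n g
  foldr-map-upTo n g = trans (cong (foldr _+_ (+ 0)) (map-applyUpTo (λ k → k) g n)) (foldr-applyUpTo n g)
    where
    foldr-applyUpTo : ∀ n (g : ℕ → ℤ) → foldr _+_ (+ 0) (applyUpTo g n) ≡ ∑ℤ n g
    foldr-applyUpTo zero    g = refl
    foldr-applyUpTo (suc n) g = cong (_+_ (g 0)) (foldr-applyUpTo n (λ k → g (suc k)))

  ∑ℤ-triangle : ∀ N (g : ℕ → ℕ → ℤ) →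
    ∑ℤ N (λ i → ∑ℤ (suc i) (g i)) ≡ ∑ℤ N (λ k → ∑ℤ (N ∸ k) (λ j → g (k ℕ.+ j) k))
  ∑ℤ-triangle zero    g = refl
  ∑ℤ-triangle (suc N) g = begin
    ∑ℤ (suc N) (λ i → ∑ℤ (suc i) (g i))
      ≡⟨ ∑ℤ-last N (λ i → ∑ℤ (suc i) (g i)) ⟩
    ∑ℤ N (λ i → ∑ℤ (suc i) (g i)) + ∑ℤ (suc N) (g N)
      ≡⟨ cong (_+ ∑ℤ (suc N) (g N)) (trans (∑ℤ-triangle N g) (sym extend)) ⟩
    ∑ℤ (suc N) (column N) + ∑ℤ (suc N) (g N)
      ≡⟨ ∑ℤ-distrib-+ (suc N) (column N) (g N) ⟨
    ∑ℤ (suc N) (λ k → column N k + g N k)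
      ≡⟨ ∑ℤ-cong (suc N) (λ k k<N+1 → sym (column-step (ℕ.≤-pred k<N+1))) ⟩
    ∑ℤ (suc N) (column (suc N)) ∎
    where
    open ≡-Reasoning
    column : ℕ → ℕ → ℤ
    column N k = ∑ℤ (N ∸ k) (λ j → g (k ℕ.+ j) k)
    extend : ∑ℤ (suc N) (column N) ≡ ∑ℤ N (column N)
    extend = trans (∑ℤ-last N (column N))
                   (trans (cong (λ n → ∑ℤ N (column N) + ∑ℤ n (λ j → g (N ℕ.+ j) N)) (ℕ.n∸n≡0 N)) (+-identityʳ _))
    column-step : ∀ {k} → k ℕ.≤ N → column (suc N) k ≡ column N k + g N k
    column-step {k} k≤N = begin
      ∑ℤ (suc N ∸ k) (λ j → g (k ℕ.+ j) k)          ≡⟨ cong (λ n → ∑ℤ n (λ j → g (k ℕ.+ j) k)) (ℕ.+-∸-assoc 1 k≤N) ⟩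
      ∑ℤ (suc (N ∸ k)) (λ j → g (k ℕ.+ j) k)        ≡⟨ ∑ℤ-last (N ∸ k) (λ j → g (k ℕ.+ j) k) ⟩
      column N k + g (k ℕ.+ (N ∸ k)) k              ≡⟨ cong (λ i → column N k + g i k) (ℕ.m+[n∸m]≡n k≤N) ⟩
      column N k + g N k                            ∎

  sgn-suc : ∀ j → sgn (suc j) ≡ - sgn j
  sgn-suc zero    = refl
  sgn-suc (suc j) = trans (sym (neg-involutive (sgn j))) (cong -_ (sym (sgn-suc j)))

  ∑ℤ-alternating-binomial-prefix : ∀ n N → ∑ℤ (suc N) (λ j → sgn j * + (suc n C j)) ≡ sgn N * + (n C N)
  ∑ℤ-alternating-binomial-prefix n zero    = refl
  ∑ℤ-alternating-binomial-prefix n (suc N) = begin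
    ∑ℤ (suc (suc N)) (λ j → sgn j * + (suc n C j))
      ≡⟨ ∑ℤ-last (suc N) (λ j → sgn j * + (suc n C j)) ⟩
    ∑ℤ (suc N) (λ j → sgn j * + (suc n C j)) + sgn (suc N) * + (suc n C suc N)
      ≡⟨ cong₂ (λ s c → s + sgn (suc N) * + c) (∑ℤ-alternating-binomial-prefix n N) (sym (nCk+nC[k+1]≡[n+1]C[k+1] n N)) ⟩
    sgn N * + (n C N) + sgn (suc N) * (+ (n C N) + + (n C suc N))
      ≡⟨ cong (λ s → sgn N * + (n C N) + s * (+ (n C N) + + (n C suc N))) (sgn-suc N) ⟩
    sgn N * + (n C N) + - sgn N * (+ (n C N) + + (n C suc N))
      ≡⟨ telescope (sgn N) (+ (n C N)) (+ (n C suc N)) ⟩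
    - sgn N * + (n C suc N)
      ≡⟨ cong (_* + (n C suc N)) (sgn-suc N) ⟨
    sgn (suc N) * + (n C suc N) ∎
    where
    open ≡-Reasoning
    telescope : ∀ s a b → s * a + - s * (a + b) ≡ - s * b
    telescope = solve-∀

  alternating-binomial : ℕ → ℤ
  alternating-binomial n = ∑ℤ (suc n) (λ j → sgn j * + (n C j))

  alternating-binomial-suc : ∀ n → alternating-binomial (suc n) ≡ + 0
  alternating-binomial-suc n = begin
    alternating-binomial (suc n)      ≡⟨ ∑ℤ-alternating-binomial-prefix n (suc n) ⟩
    sgn (suc n) * + (n C suc n)       ≡⟨ cong (λ c → sgn (suc n) * + c) (k>n⇒nCk≡0 (ℕ.n<1+n n)) ⟩
    sgn (suc n) * + 0                 ≡⟨ *-zeroʳ (sgn (suc n)) ⟩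
    + 0                               ∎
    where open ≡-Reasoning

  -- Exchanging the sums leaves, for each k, F k times an alternating binomial sum over
  -- 0 ≤ j ≤ D − k, which vanishes unless k = D.
  ∑ℤ-h-vector : ∀ D (F : ℕ → ℤ) →
    ∑ℤ (suc D) (λ i → ∑ℤ (suc i) (λ k → sgn (i ∸ k) * + ((D ∸ k) C (i ∸ k)) * F k)) ≡ F D
  ∑ℤ-h-vector D F = begin
    ∑ℤ (suc D) (λ i → ∑ℤ (suc i) (g i))
      ≡⟨ ∑ℤ-triangle (suc D) g ⟩
    ∑ℤ (suc D) (λ k → ∑ℤ (suc D ∸ k) (λ j → g (k ℕ.+ j) k))
      ≡⟨ ∑ℤ-cong (suc D) (λ k k≤D → column (ℕ.≤-pred k≤D)) ⟩
    ∑ℤ (suc D) (λ k → alternating-binomial (D ∸ k) * F k)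
      ≡⟨ ∑ℤ-last D (λ k → alternating-binomial (D ∸ k) * F k) ⟩
    ∑ℤ D (λ k → alternating-binomial (D ∸ k) * F k) + alternating-binomial (D ∸ D) * F D
      ≡⟨ cong₂ _+_ (∑ℤ-zero D _ below-D) (cong (λ n → alternating-binomial n * F D) (ℕ.n∸n≡0 D)) ⟩
    + 0 + + 1 * F D
      ≡⟨ trans (+-identityˡ _) (*-identityˡ (F D)) ⟩
    F D ∎
    where
    open ≡-Reasoning
    g : ℕ → ℕ → ℤ
    g i k = sgn (i ∸ k) * + ((D ∸ k) C (i ∸ k)) * F k
    column : ∀ {k} → k ℕ.≤ D → ∑ℤ (suc D ∸ k) (λ j → g (k ℕ.+ j) k) ≡ alternating-binomial (D ∸ k) * F k
    column {k} k≤D = begin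
      ∑ℤ (suc D ∸ k) (λ j → g (k ℕ.+ j) k)
        ≡⟨ cong (λ n → ∑ℤ n (λ j → g (k ℕ.+ j) k)) (ℕ.+-∸-assoc 1 k≤D) ⟩
      ∑ℤ (suc (D ∸ k)) (λ j → g (k ℕ.+ j) k)
        ≡⟨ ∑ℤ-cong (suc (D ∸ k)) (λ j _ → cong (λ i → sgn i * + ((D ∸ k) C i) * F k) (ℕ.m+n∸m≡n k j)) ⟩
      ∑ℤ (suc (D ∸ k)) (λ j → sgn j * + ((D ∸ k) C j) * F k)
        ≡⟨ ∑ℤ-distribʳ (suc (D ∸ k)) (λ j → sgn j * + ((D ∸ k) C j)) (F k) ⟩
      alternating-binomial (D ∸ k) * F k ∎
    below-D : ∀ k → k ℕ.< D → alternating-binomial (D ∸ k) * F k ≡ + 0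
    below-D k k<D with D ∸ k | ℕ.m>n⇒m∸n≢0 k<D
    ... | zero  | D∸k≢0 = contradiction refl D∸k≢0
    ... | suc n | _     = trans (cong (_* F k) (alternating-binomial-suc n)) (*-zeroˡ (F k))

  ∑ℤ-hvec : ∀ {n d} (Δ : SimplicialComplex n d) → ∑ℤ (suc d) (hvecℤ Δ) ≡ + fvec Δ d
  ∑ℤ-hvec {d = d} Δ = trans
    (∑ℤ-cong (suc d) (λ i _ → foldr-map-upTo (suc i) (λ k → sgn (i ∸ k) * + ((d ∸ k) C (i ∸ k)) * + fvec Δ k)))
    (∑ℤ-h-vector d (λ k → + fvec Δ k))

module Faces where
  open import Data.Bool using (true; false)
  import Data.Bool as Bool
  open import Data.Nat using (zero; suc; _<_; _≟_)
  open import Data.Vec using ([]; _∷_)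
  open import Data.Fin.Subset using (Subset; ∣_∣)
  open import Data.List using (map)
  open import Data.List.Properties using (filter-some)
  open import Data.List.Relation.Unary.Any using (here)
  open import Data.List.Membership.Propositional using (_∈_; lose)
  open import Data.List.Membership.Propositional.Properties using (∈-map⁺; ∈-++⁺ˡ; ∈-++⁺ʳ; ∈-filter⁺)
  open import Data.Product using (_,_)
  open import Relation.Binary.PropositionalEquality using (refl)

  allSubsets-complete : ∀ n (σ : Subset n) → σ ∈ allSubsets n
  allSubsets-complete zero    []          = here refl
  allSubsets-complete (suc n) (true ∷ σ)  = ∈-++⁺ˡ (∈-map⁺ (true ∷_) (allSubsets-complete n σ))
  allSubsets-complete (suc n) (false ∷ σ) =
    ∈-++⁺ʳ (map (true ∷_) (allSubsets n)) (∈-map⁺ (false ∷_) (allSubsets-complete n σ))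

  fvec-facets-positive : ∀ {n d} (Δ : SimplicialComplex n d) → 0 < fvec Δ d
  fvec-facets-positive {n} {d} Δ with SimplicialComplex.topFace Δ
  ... | σ , σ∈Δ , ∣σ∣≡d = filter-some (λ τ → SimplicialComplex.face Δ τ Bool.≟ true)
    (lose (∈-filter⁺ (λ τ → ∣ τ ∣ ≟ d) (allSubsets-complete n σ) ∣σ∣≡d) σ∈Δ)

module Eigenbasis where
  open import Data.Nat as ℕ using (ℕ; zero; suc; z≤n; s≤s; _!)
  import Data.Nat.Properties as ℕ
  import Data.Nat.Coprimality as Coprime
  open import Data.Integer as ℤ using (ℤ)
  import Data.Integer.Properties as ℤ
  open import Data.Rational
    using (ℚ; mkℚ; ↥_; 0ℚ; 1ℚ; _+_; _*_; -_; _-_; 1/_; ∣_∣; _≤_; _<_; *≤*; *<*; positive; nonNegative; ≢-nonZero)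
  open import Data.Rational.Properties
  open import Data.Fin as Fin using (Fin; zero; suc; toℕ; fromℕ)
  import Data.Fin.Properties as Fin
  open import Data.Vec.Functional using (Vector; removeAt; _∷_)
  open import Data.Product using (∃; _×_; _,_; proj₁; proj₂)
  open import Data.Sum using (inj₁; inj₂)
  open import Data.Empty using (⊥)
  open import Function using (_∘_)
  open import Level using (0ℓ)
  open import Relation.Nullary using (yes; no; contradiction)
  open import Relation.Nullary.Decidable using (dec⇒maybe)
  open import Relation.Binary.PropositionalEquality
  open import Relation.Binary.Definitions using (tri<; tri≈; tri>)
  open import Tactic.RingSolver using (solve-∀)
  open import Tactic.RingSolver.Core.AlmostCommutativeRing using (AlmostCommutativeRing; fromCommutativeRing)
  open import Algebra.Bundles using (CommutativeRing; CommutativeMonoid)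
  open import Algebra.Properties.Group (CommutativeRing.+-group +-*-commutativeRing) using (x∙y⁻¹≈ε⇒x≈y)
  open import Algebra.Properties.CommutativeSemigroup (CommutativeMonoid.commutativeSemigroup *-1-commutativeMonoid)
    using (x∙yz≈y∙xz)
  open import Algebra.Properties.Semiring.Sum (CommutativeRing.semiring +-*-commutativeRing)
    using (sum; sum-cong-≗; sum-replicate-zero; sum-remove; ∑-distrib-+; ∑-comm; *-distribˡ-sum; *-distribʳ-sum)
  import Algebra.Properties.Semiring.Sum ℕ.+-*-semiring as ℕΣ
  open Permutations using (A-column-sum; A-row₀-off; A-row₀-diag≤1; A-row-max-off; A-row-max-diag≤1; A-row₁-pos; A-column₂-pos)
  open HVector using (∑ℤ; ∑ℤ-hvec)
  open Faces using (fvec-facets-positive)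

  ℚ-ring : AlmostCommutativeRing 0ℓ 0ℓ
  ℚ-ring = fromCommutativeRing +-*-commutativeRing (λ x → dec⇒maybe (0ℚ ≟ x))

  ℤ→ℚ≡mkℚ : ∀ z → ℤ→ℚ z ≡ mkℚ z 0 (Coprime.sym (Coprime.1-coprimeTo _))
  ℤ→ℚ≡mkℚ z = ↥p/↧p≡p (mkℚ z 0 (Coprime.sym (Coprime.1-coprimeTo _)))

  ℤ→ℚ-+ : ∀ a b → ℤ→ℚ (a ℤ.+ b) ≡ ℤ→ℚ a + ℤ→ℚ b
  ℤ→ℚ-+ a b = sym (begin
    ℤ→ℚ a + ℤ→ℚ b                        ≡⟨ cong₂ _+_ (ℤ→ℚ≡mkℚ a) (ℤ→ℚ≡mkℚ b) ⟩
    ℤ→ℚ (a ℤ.* ℤ.+ 1 ℤ.+ b ℤ.* ℤ.+ 1)    ≡⟨ cong ℤ→ℚ (cong₂ ℤ._+_ (ℤ.*-identityʳ a) (ℤ.*-identityʳ b)) ⟩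
    ℤ→ℚ (a ℤ.+ b)                        ∎)
    where open ≡-Reasoning

  ℕ→ℚ-+ : ∀ m n → ℕ→ℚ (m ℕ.+ n) ≡ ℕ→ℚ m + ℕ→ℚ n
  ℕ→ℚ-+ m n = ℤ→ℚ-+ (ℤ.+ m) (ℤ.+ n)

  ℕ→ℚ-injective : ∀ {m n} → ℕ→ℚ m ≡ ℕ→ℚ n → m ≡ n
  ℕ→ℚ-injective {m} {n} eq =
    ℤ.+-injective (cong ↥_ (trans (sym (ℤ→ℚ≡mkℚ (ℤ.+ m))) (trans eq (ℤ→ℚ≡mkℚ (ℤ.+ n)))))

  ℕ→ℚ-mono-≤ : ∀ {m n} → m ℕ.≤ n → ℕ→ℚ m ≤ ℕ→ℚ n
  ℕ→ℚ-mono-≤ {m} {n} m≤n rewrite ℤ→ℚ≡mkℚ (ℤ.+ m) | ℤ→ℚ≡mkℚ (ℤ.+ n) =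
    *≤* (ℤ.*-monoʳ-≤-nonNeg (ℤ.+ 1) (ℤ.+≤+ m≤n))

  ℕ→ℚ-mono-< : ∀ {m n} → m ℕ.< n → ℕ→ℚ m < ℕ→ℚ n
  ℕ→ℚ-mono-< {m} {n} m<n rewrite ℤ→ℚ≡mkℚ (ℤ.+ m) | ℤ→ℚ≡mkℚ (ℤ.+ n) =
    *<* (ℤ.*-monoʳ-<-pos (ℤ.+ 1) (ℤ.+<+ m<n))

  p≢0∧p*q≡0⇒q≡0 : ∀ {p q} → p ≢ 0ℚ → p * q ≡ 0ℚ → q ≡ 0ℚ
  p≢0∧p*q≡0⇒q≡0 {p} {q} p≢0 pq≡0 = begin
    q               ≡⟨ *-identityˡ q ⟨
    1ℚ * q          ≡⟨ cong (_* q) (*-inverseˡ p) ⟨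
    p⁻¹ * p * q     ≡⟨ *-assoc p⁻¹ p q ⟩
    p⁻¹ * (p * q)   ≡⟨ cong (p⁻¹ *_) pq≡0 ⟩
    p⁻¹ * 0ℚ        ≡⟨ *-zeroʳ p⁻¹ ⟩
    0ℚ              ∎
    where
    open ≡-Reasoning
    instance _ = ≢-nonZero p≢0
    p⁻¹ = 1/ p

  p≢q∧p*r≡q*r⇒r≡0 : ∀ {p q r} → p ≢ q → p * r ≡ q * r → r ≡ 0ℚ
  p≢q∧p*r≡q*r⇒r≡0 {p} {q} {r} p≢q pr≡qr = p≢0∧p*q≡0⇒q≡0 (p≢q ∘ x∙y⁻¹≈ε⇒x≈y p q) (begin
    (p - q) * r       ≡⟨ *-distribʳ-+ r p (- q) ⟩
    p * r + - q * r   ≡⟨ cong (λ x → x + - q * r) pr≡qr ⟩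
    q * r + - q * r   ≡⟨ cong (q * r +_) (neg-distribˡ-* q r) ⟨
    q * r - q * r     ≡⟨ +-inverseʳ (q * r) ⟩
    0ℚ                ∎)
    where open ≡-Reasoning

  pos*pos : ∀ {p q} → 0ℚ < p → 0ℚ < q → 0ℚ < p * q
  pos*pos {p} {q} 0<p 0<q = subst (_< p * q) (*-zeroʳ p) (*-monoʳ-<-pos p {{positive 0<p}} 0<q)

  pos*neg : ∀ {p q} → 0ℚ < p → q < 0ℚ → p * q < 0ℚ
  pos*neg {p} {q} 0<p q<0 = subst (p * q <_) (*-zeroʳ p) (*-monoʳ-<-pos p {{positive 0<p}} q<0)

  nonNeg*nonNeg : ∀ {p q} → 0ℚ ≤ p → 0ℚ ≤ q → 0ℚ ≤ p * q
  nonNeg*nonNeg {p} {q} 0≤p 0≤q = subst (_≤ p * q) (*-zeroʳ p) (*-monoˡ-≤-nonNeg p {{nonNegative 0≤p}} 0≤q)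

  0<p∧0<p*q⇒0<q : ∀ {p q} → 0ℚ < p → 0ℚ < p * q → 0ℚ < q
  0<p∧0<p*q⇒0<q {p} {q} 0<p 0<pq = ≰⇒> λ q≤0 →
    <-irrefl refl (<-≤-trans 0<pq (subst (p * q ≤_) (*-zeroʳ p) (*-monoˡ-≤-nonNeg p {{nonNegative (<⇒≤ 0<p)}} q≤0)))

  p≤∣p∣ : ∀ p → p ≤ ∣ p ∣
  p≤∣p∣ (mkℚ (ℤ.+ n)    _ _) = ≤-refl
  p≤∣p∣ (mkℚ ℤ.-[1+ n ] _ _) = *≤* ℤ.-≤+

  Σℚ-cong : ∀ {n} {f g : Vector ℚ n} → (∀ i → f i ≡ g i) → Σℚ f ≡ Σℚ g
  Σℚ-cong {zero}  f≗g = refl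
  Σℚ-cong {suc n} f≗g = cong₂ _+_ (f≗g zero) (Σℚ-cong (f≗g ∘ suc))

  Σℚ-zero : ∀ {n} {f : Vector ℚ n} → (∀ i → f i ≡ 0ℚ) → Σℚ f ≡ 0ℚ
  Σℚ-zero {zero}  f≡0 = refl
  Σℚ-zero {suc n} f≡0 = trans (cong₂ _+_ (f≡0 zero) (Σℚ-zero (f≡0 ∘ suc))) (+-identityʳ 0ℚ)

  Σℚ≡sum : ∀ {n} (f : Vector ℚ n) → Σℚ f ≡ sum f
  Σℚ≡sum {zero}  f = refl
  Σℚ≡sum {suc n} f = cong (f zero +_) (Σℚ≡sum (f ∘ suc))

  ·≡sum : ∀ {n} (M : Fin n → Fin n → ℚ) v i → (M · v) i ≡ sum (λ j → M i j * v j)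
  ·≡sum M v i = Σℚ≡sum (λ j → M i j * v j)

  lincomb≡sum : ∀ {k n} (c : Vector ℚ k) (b : Fin k → Vector ℚ n) i → lincomb c b i ≡ sum (λ k → c k * b k i)
  lincomb≡sum c b i = Σℚ≡sum (λ k → c k * b k i)

  ℕ→ℚ-sum : ∀ {n} (t : Vector ℕ n) → ℕ→ℚ (ℕΣ.sum t) ≡ sum (ℕ→ℚ ∘ t)
  ℕ→ℚ-sum {zero}  t = refl
  ℕ→ℚ-sum {suc n} t = trans (ℕ→ℚ-+ (t zero) _) (cong (ℕ→ℚ (t zero) +_) (ℕ→ℚ-sum (t ∘ suc)))

  ℤ→ℚ-∑ℤ : ∀ n (g : ℕ → ℤ) → ℤ→ℚ (∑ℤ n g) ≡ sum {n} (λ i → ℤ→ℚ (g (toℕ i)))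
  ℤ→ℚ-∑ℤ zero    g = refl
  ℤ→ℚ-∑ℤ (suc n) g = trans (ℤ→ℚ-+ (g 0) _) (cong (ℤ→ℚ (g 0) +_) (ℤ→ℚ-∑ℤ n (g ∘ suc)))

  sum-single : ∀ {n} (f : Vector ℚ n) j → (∀ i → i ≢ j → f i ≡ 0ℚ) → sum f ≡ f j
  sum-single {suc n} f j f≡0 = begin
    sum f                          ≡⟨ sum-remove {i = j} f ⟩
    f j + sum (removeAt f j)       ≡⟨ cong (f j +_) (sum-cong-≗ (λ k → f≡0 (Fin.punchIn j k) (Fin.punchInᵢ≢i j k))) ⟩
    f j + sum {n} (λ _ → 0ℚ)       ≡⟨ cong (f j +_) (sum-replicate-zero n) ⟩
    f j + 0ℚ                       ≡⟨ +-identityʳ (f j) ⟩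
    f j                            ∎
    where open ≡-Reasoning

  sum-lincomb : ∀ {k n} (a : Vector ℚ k) (w : Fin k → Vector ℚ n) → sum (lincomb a w) ≡ sum (λ l → a l * sum (w l))
  sum-lincomb a w = begin
    sum (lincomb a w)                          ≡⟨ sum-cong-≗ (lincomb≡sum a w) ⟩
    sum (λ i → sum (λ l → a l * w l i))        ≡⟨ ∑-comm (λ i l → a l * w l i) ⟩
    sum (λ l → sum (λ i → a l * w l i))        ≡⟨ sum-cong-≗ (λ l → *-distribˡ-sum (a l) (w l)) ⟨
    sum (λ l → a l * sum (w l))                ∎
    where open ≡-Reasoning

  sum-mono-≤ : ∀ {n} {f g : Vector ℚ n} → (∀ i → f i ≤ g i) → sum f ≤ sum g
  sum-mono-≤ {zero}  f≤g = ≤-refl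
  sum-mono-≤ {suc n} f≤g = +-mono-≤ (f≤g zero) (sum-mono-≤ (f≤g ∘ suc))

  sum-mono-< : ∀ {n} {f g : Vector ℚ n} → (∀ i → f i ≤ g i) → ∀ j → f j < g j → sum f < sum g
  sum-mono-< {suc n} f≤g zero    fj<gj = +-mono-<-≤ fj<gj (sum-mono-≤ (f≤g ∘ suc))
  sum-mono-< {suc n} f≤g (suc j) fj<gj = +-mono-≤-< (f≤g zero) (sum-mono-< (f≤g ∘ suc) j fj<gj)

  sum-nonneg : ∀ {n} {f : Vector ℚ n} → (∀ i → 0ℚ ≤ f i) → 0ℚ ≤ sum f
  sum-nonneg {n} {f} 0≤f = subst (_≤ sum f) (sum-replicate-zero n) (sum-mono-≤ 0≤f)

  term≤sum : ∀ {n} (f : Vector ℚ n) → (∀ i → 0ℚ ≤ f i) → ∀ j → f j ≤ sum f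
  term≤sum f 0≤f zero    =
    subst (_≤ sum f) (+-identityʳ (f zero)) (+-mono-≤ (≤-refl {f zero}) (sum-nonneg (0≤f ∘ suc)))
  term≤sum f 0≤f (suc j) =
    subst (_≤ sum f) (+-identityˡ (f (suc j))) (+-mono-≤ (0≤f zero) (term≤sum (f ∘ suc) (0≤f ∘ suc) j))

  ∣sum∣≤sum∣∣ : ∀ {n} (f : Vector ℚ n) → ∣ sum f ∣ ≤ sum (λ j → ∣ f j ∣)
  ∣sum∣≤sum∣∣ {zero}  f = ≤-refl
  ∣sum∣≤sum∣∣ {suc n} f =
    ≤-trans (∣p+q∣≤∣p∣+∣q∣ (f zero) (sum (f ∘ suc))) (+-mono-≤ (≤-refl {∣ f zero ∣}) (∣sum∣≤sum∣∣ (f ∘ suc)))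

  neg-sum : ∀ {n} (f : Vector ℚ n) → - sum f ≡ sum (λ j → - f j)
  neg-sum {zero}  f = refl
  neg-sum {suc n} f = trans (neg-distrib-+ (f zero) (sum (f ∘ suc))) (cong (- f zero +_) (neg-sum (f ∘ suc)))

  ∣sum∣<sum∣∣ : ∀ {n} (f : Vector ℚ n) p q → 0ℚ < f p → f q < 0ℚ → ∣ sum f ∣ < sum (λ j → ∣ f j ∣)
  ∣sum∣<sum∣∣ f p q 0<fp fq<0 with ∣p∣≡p∨∣p∣≡-p (sum f)
  ... | inj₁ ∣Σ∣≡Σ = subst (_< sum (λ j → ∣ f j ∣)) (sym ∣Σ∣≡Σ)
    (sum-mono-< (λ j → p≤∣p∣ (f j)) q (<-≤-trans fq<0 (0≤∣p∣ (f q))))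
  ... | inj₂ ∣Σ∣≡-Σ = subst (_< sum (λ j → ∣ f j ∣)) (sym (trans ∣Σ∣≡-Σ (neg-sum f)))
    (sum-mono-< (λ j → subst (- f j ≤_) (∣-p∣≡∣p∣ (f j)) (p≤∣p∣ (- f j))) p
                (<-≤-trans (neg-antimono-< 0<fp) (0≤∣p∣ (f p))))

  Matrix : ℕ → Set
  Matrix n = Fin n → Fin n → ℚ

  module _ {n : ℕ} (M : Matrix n) where

    ·-scale : ∀ ε (x : Vector ℚ n) i → (M · (λ j → ε * x j)) i ≡ ε * (M · x) i
    ·-scale ε x i = begin
      (M · (λ j → ε * x j)) i            ≡⟨ ·≡sum M _ i ⟩
      sum (λ j → M i j * (ε * x j))      ≡⟨ sum-cong-≗ (λ j → x∙yz≈y∙xz (M i j) ε (x j)) ⟩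
      sum (λ j → ε * (M i j * x j))      ≡⟨ *-distribˡ-sum ε (λ j → M i j * x j) ⟨
      ε * sum (λ j → M i j * x j)        ≡⟨ cong (ε *_) (·≡sum M x i) ⟨
      ε * (M · x) i                      ∎
      where open ≡-Reasoning

    ·-linear : ∀ α β (x y : Vector ℚ n) i →
               (M · (λ j → α * x j + β * y j)) i ≡ α * (M · x) i + β * (M · y) i
    ·-linear α β x y i = begin
      (M · (λ j → α * x j + β * y j)) i
        ≡⟨ ·≡sum M _ i ⟩
      sum (λ j → M i j * (α * x j + β * y j))
        ≡⟨ sum-cong-≗ (λ j → distrib (M i j) α β (x j) (y j)) ⟩
      sum (λ j → α * (M i j * x j) + β * (M i j * y j))
        ≡⟨ ∑-distrib-+ (λ j → α * (M i j * x j)) (λ j → β * (M i j * y j)) ⟩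
      sum (λ j → α * (M i j * x j)) + sum (λ j → β * (M i j * y j))
        ≡⟨ cong₂ _+_ (*-distribˡ-sum α (λ j → M i j * x j)) (*-distribˡ-sum β (λ j → M i j * y j)) ⟨
      α * sum (λ j → M i j * x j) + β * sum (λ j → M i j * y j)
        ≡⟨ cong₂ (λ a b → α * a + β * b) (·≡sum M x i) (·≡sum M y i) ⟨
      α * (M · x) i + β * (M · y) i ∎
      where
      open ≡-Reasoning
      distrib : ∀ m α β x y → m * (α * x + β * y) ≡ α * (m * x) + β * (m * y)
      distrib = solve-∀ ℚ-ring

    ·-column-sums : ∀ {s} → (∀ j → sum (λ i → M i j) ≡ s) → ∀ v → sum (M · v) ≡ s * sum v
    ·-column-sums {s} colsum v = begin
      sum (M · v)                              ≡⟨ sum-cong-≗ (·≡sum M v) ⟩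
      sum (λ i → sum (λ j → M i j * v j))      ≡⟨ ∑-comm (λ i j → M i j * v j) ⟩
      sum (λ j → sum (λ i → M i j * v j))      ≡⟨ sum-cong-≗ (λ j → *-distribʳ-sum (v j) (λ i → M i j)) ⟨
      sum (λ j → sum (λ i → M i j) * v j)      ≡⟨ sum-cong-≗ (λ j → cong (_* v j) (colsum j)) ⟩
      sum (λ j → s * v j)                      ≡⟨ *-distribˡ-sum s v ⟨
      s * sum v                                ∎
      where open ≡-Reasoning

    eigenvector-scale : ∀ {λ′ v} ε → ε ≢ 0ℚ → IsEigenvector M λ′ v → IsEigenvector M λ′ (λ i → ε * v i)
    eigenvector-scale {λ′} {v} ε ε≢0 ((i , vi≢0) , eigen) =
      (i , vi≢0 ∘ p≢0∧p*q≡0⇒q≡0 ε≢0) , λ j → begin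
        (M · (λ k → ε * v k)) j   ≡⟨ ·-scale ε v j ⟩
        ε * (M · v) j             ≡⟨ cong (ε *_) (eigen j) ⟩
        ε * (λ′ * v j)            ≡⟨ x∙yz≈y∙xz ε λ′ (v j) ⟩
        λ′ * (ε * v j)            ∎
      where open ≡-Reasoning

    eigenvector-combination : ∀ {λ′ x y} → (∀ i → (M · x) i ≡ λ′ * x i) → (∀ i → (M · y) i ≡ λ′ * y i) →
      ∀ α β i → (M · (λ j → α * x j + β * y j)) i ≡ λ′ * (α * x i + β * y i)
    eigenvector-combination {λ′} {x} {y} eigen-x eigen-y α β i = begin
      (M · (λ j → α * x j + β * y j)) i   ≡⟨ ·-linear α β x y i ⟩
      α * (M · x) i + β * (M · y) i       ≡⟨ cong₂ (λ a b → α * a + β * b) (eigen-x i) (eigen-y i) ⟩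
      α * (λ′ * x i) + β * (λ′ * y i)     ≡⟨ regroup α β λ′ (x i) (y i) ⟩
      λ′ * (α * x i + β * y i)            ∎
      where
      open ≡-Reasoning
      regroup : ∀ α β l x y → α * (l * x) + β * (l * y) ≡ l * (α * x + β * y)
      regroup = solve-∀ ℚ-ring

    eigenvector-isolated-row : ∀ {λ′ v} r → (∀ j → j ≢ r → M r j ≡ 0ℚ) → M r r ≢ λ′ →
                               (∀ i → (M · v) i ≡ λ′ * v i) → v r ≡ 0ℚ
    eigenvector-isolated-row {λ′} {v} r row≡0 Mrr≢λ eigen = p≢q∧p*r≡q*r⇒r≡0 Mrr≢λ (begin
      M r r * v r                ≡⟨ sum-single (λ j → M r j * v j) r
                                      (λ j j≢r → trans (cong (_* v j) (row≡0 j j≢r)) (*-zeroˡ (v j))) ⟨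
      sum (λ j → M r j * v j)    ≡⟨ ·≡sum M v r ⟨
      (M · v) r                  ≡⟨ eigen r ⟩
      λ′ * v r                   ∎)
      where open ≡-Reasoning

    eigenvector-sum : ∀ {s λ′ v} → (∀ j → sum (λ i → M i j) ≡ s) → λ′ ≢ s →
                      (∀ i → (M · v) i ≡ λ′ * v i) → sum v ≡ 0ℚ
    eigenvector-sum {s} {λ′} {v} colsum λ≢s eigen = p≢q∧p*r≡q*r⇒r≡0 λ≢s (begin
      λ′ * sum v             ≡⟨ *-distribˡ-sum λ′ v ⟩
      sum (λ i → λ′ * v i)   ≡⟨ sum-cong-≗ eigen ⟨
      sum (M · v)            ≡⟨ ·-column-sums colsum v ⟩
      s * sum v              ∎)
      where open ≡-Reasoning

  module _ {n : ℕ} (M : Matrix n) (M≥0 : ∀ i j → 0ℚ ≤ M i j) where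

    eigenvector-positive : ∀ {s y} → 0ℚ < s → (∀ j → 0ℚ ≤ y j) → (∀ i → (M · y) i ≡ s * y i) →
                           ∀ {i j} → 0ℚ < M i j → 0ℚ < y j → 0ℚ < y i
    eigenvector-positive {s} {y} 0<s y≥0 eigen {i} {j} 0<Mij 0<yj = 0<p∧0<p*q⇒0<q 0<s (begin-strict
      0ℚ                        <⟨ pos*pos 0<Mij 0<yj ⟩
      M i j * y j               ≤⟨ term≤sum (λ k → M i k * y k) (λ k → nonNeg*nonNeg (M≥0 i k) (y≥0 k)) j ⟩
      sum (λ k → M i k * y k)   ≡⟨ ·≡sum M y i ⟨
      (M · y) i                 ≡⟨ eigen i ⟩
      s * y i                   ∎)
      where open ≤-Reasoning

    -- Each row satisfies s·∣x k∣ = ∣(M · x) k∣ ≤ (M · ∣x∣) k, and summing over k gives equality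
    -- because of the column sums; a row with terms of both signs would make its inequality strict.
    eigenvector-no-cancellation : ∀ {s x} → (∀ j → sum (λ i → M i j) ≡ s) → 0ℚ ≤ s →
      (∀ i → (M · x) i ≡ s * x i) → ∀ i p q → 0ℚ < M i p * x p → M i q * x q < 0ℚ → ⊥
    eigenvector-no-cancellation {s} {x} colsum 0≤s eigen i p q 0<Mx Mx<0 =
      <-irrefl refl (begin-strict
        sum (λ k → s * ∣x∣ k)    <⟨ sum-mono-< row-bound i row-strict ⟩
        sum (M · ∣x∣)             ≡⟨ ·-column-sums M colsum ∣x∣ ⟩
        s * sum ∣x∣               ≡⟨ *-distribˡ-sum s ∣x∣ ⟩
        sum (λ k → s * ∣x∣ k)    ∎)
      where
      open ≤-Reasoning
      ∣x∣ : Vector ℚ n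
      ∣x∣ j = ∣ x j ∣
      ∣row∣ : ∀ k → ∣ (M · x) k ∣ ≡ s * ∣x∣ k
      ∣row∣ k = trans (cong ∣_∣ (eigen k)) (trans (∣p*q∣≡∣p∣*∣q∣ s (x k)) (cong (_* ∣x∣ k) (0≤p⇒∣p∣≡p 0≤s)))
      ∣term∣ : ∀ k j → ∣ M k j * x j ∣ ≡ M k j * ∣x∣ j
      ∣term∣ k j = trans (∣p*q∣≡∣p∣*∣q∣ (M k j) (x j)) (cong (_* ∣x∣ j) (0≤p⇒∣p∣≡p (M≥0 k j)))
      row-bound : ∀ k → s * ∣x∣ k ≤ (M · ∣x∣) k
      row-bound k = begin
        s * ∣x∣ k                  ≡⟨ ∣row∣ k ⟨
        ∣ (M · x) k ∣              ≡⟨ cong ∣_∣ (·≡sum M x k) ⟩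
        ∣ sum (λ j → M k j * x j) ∣ ≤⟨ ∣sum∣≤sum∣∣ (λ j → M k j * x j) ⟩
        sum (λ j → ∣ M k j * x j ∣) ≡⟨ sum-cong-≗ (∣term∣ k) ⟩
        sum (λ j → M k j * ∣x∣ j)  ≡⟨ ·≡sum M ∣x∣ k ⟨
        (M · ∣x∣) k                ∎
      row-strict : s * ∣x∣ i < (M · ∣x∣) i
      row-strict = begin-strict
        s * ∣x∣ i                  ≡⟨ ∣row∣ i ⟨
        ∣ (M · x) i ∣              ≡⟨ cong ∣_∣ (·≡sum M x i) ⟩
        ∣ sum (λ j → M i j * x j) ∣ <⟨ ∣sum∣<sum∣∣ (λ j → M i j * x j) p q 0<Mx Mx<0 ⟩
        sum (λ j → ∣ M i j * x j ∣) ≡⟨ sum-cong-≗ (∣term∣ i) ⟩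
        sum (λ j → M i j * ∣x∣ j)  ≡⟨ ·≡sum M ∣x∣ i ⟨
        (M · ∣x∣) i                ∎

  same-sign⇒nonneg-multiple : ∀ {n} (x : Vector ℚ n) → (∃ λ i → x i ≢ 0ℚ) →
    (∀ p q → 0ℚ < x p → x q < 0ℚ → ⊥) →
    ∃ λ ε → ε ≢ 0ℚ × (∀ j → 0ℚ ≤ ε * x j) × ∃ λ p → 0ℚ < ε * x p
  same-sign⇒nonneg-multiple x (i , xi≢0) no-mixed with Fin.any? (λ p → 0ℚ <? x p)
  ... | yes (p , 0<xp) = 1ℚ , 1≢0 , (λ j → subst (0ℚ ≤_) (sym (*-identityˡ (x j))) (≮⇒≥ (no-mixed p j 0<xp))) ,
                         p , subst (0ℚ <_) (sym (*-identityˡ (x p))) 0<xp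
  ... | no ∄positive = - 1ℚ , (λ ()) , (λ j → subst (0ℚ ≤_) (-1* (x j)) (neg-antimono-≤ (x≤0 j))) ,
                       i , subst (0ℚ <_) (-1* (x i)) (neg-antimono-< (≤∧≢⇒< (x≤0 i) xi≢0))
    where
    x≤0 : ∀ j → x j ≤ 0ℚ
    x≤0 j = ≮⇒≥ (λ 0<xj → ∄positive (j , 0<xj))
    -1* : ∀ q → - q ≡ - 1ℚ * q
    -1* q = trans (cong -_ (sym (*-identityˡ q))) (neg-distribˡ-* 1ℚ q)
    ≤∧≢⇒< : ∀ {p q} → p ≤ q → p ≢ q → p < q
    ≤∧≢⇒< {p} {q} p≤q p≢q with <-cmp p q
    ... | tri< p<q _ _ = p<q
    ... | tri≈ _ p≡q _ = contradiction p≡q p≢q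
    ... | tri> _ _ q<p = contradiction (<-≤-trans q<p p≤q) (<-irrefl refl)

  module _ {k n : ℕ} where

    IsBasis-cong : ∀ {b b′ : Fin k → Vector ℚ n} → (∀ l i → b l i ≡ b′ l i) → IsBasis b → IsBasis b′
    IsBasis-cong {b} {b′} b≗b′ (independent , spanning) =
      (λ c c·b′≡0 → independent c (λ i → trans (same c i) (c·b′≡0 i))) ,
      (λ v → let c , c·b≡v = spanning v in c , λ i → trans (sym (same c i)) (c·b≡v i))
      where
      same : ∀ c i → lincomb c b i ≡ lincomb c b′ i
      same c i = Σℚ-cong (λ l → cong (c l *_) (b≗b′ l i))

    IsBasis-scale : ∀ {b : Fin k → Vector ℚ n} (ε : Vector ℚ k) → (∀ l → ε l ≢ 0ℚ) → IsBasis b →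
                    IsBasis (λ l i → ε l * b l i)
    IsBasis-scale {b} ε ε≢0 (independent , spanning) = independent′ , spanning′
      where
      independent′ : ∀ c → (∀ i → lincomb c (λ l i → ε l * b l i) i ≡ 0ℚ) → ∀ l → c l ≡ 0ℚ
      independent′ c c·εb≡0 l = p≢0∧p*q≡0⇒q≡0 (ε≢0 l) (trans (*-comm (ε l) (c l))
        (independent (λ l → c l * ε l) (λ i → trans (Σℚ-cong (λ l → *-assoc (c l) (ε l) (b l i))) (c·εb≡0 i)) l))
      spanning′ : ∀ v → ∃ λ c → ∀ i → lincomb c (λ l i → ε l * b l i) i ≡ v i
      spanning′ v = (λ l → c l * ε⁻¹ l) , λ i → trans (Σℚ-cong (λ l → cancel l (b l i))) (c·b≡v i)
        where
        c = proj₁ (spanning v)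
        c·b≡v = proj₂ (spanning v)
        ε⁻¹ : Vector ℚ k
        ε⁻¹ l = (1/ ε l) {{≢-nonZero (ε≢0 l)}}
        cancel : ∀ l x → c l * ε⁻¹ l * (ε l * x) ≡ c l * x
        cancel l x = begin
          c l * ε⁻¹ l * (ε l * x)     ≡⟨ regroup (c l) (ε⁻¹ l) (ε l) x ⟩
          c l * (ε⁻¹ l * ε l * x)     ≡⟨ cong (λ e → c l * (e * x)) (*-inverseˡ (ε l) {{≢-nonZero (ε≢0 l)}}) ⟩
          c l * (1ℚ * x)              ≡⟨ cong (c l *_) (*-identityˡ x) ⟩
          c l * x                     ∎
          where
          open ≡-Reasoning
          regroup : ∀ c e f x → c * e * (f * x) ≡ c * (e * f * x)
          regroup = solve-∀ ℚ-ring

  IsEigenbasis-cong : ∀ {d} {w w′ : Fin (suc d) → Vector ℚ (suc d)} → (∀ l i → w l i ≡ w′ l i) →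
                      IsEigenbasis d w → IsEigenbasis d w′
  IsEigenbasis-cong {d} w≗w′ (basis , eigen) = IsBasis-cong w≗w′ basis , λ l → eigenvector-cong {eigval l} (w≗w′ l) (eigen l)
    where
    eigenvector-cong : ∀ {λ′ v v′} → (∀ i → v i ≡ v′ i) → IsEigenvector (H d) λ′ v → IsEigenvector (H d) λ′ v′
    eigenvector-cong {λ′} v≗v′ ((i , vi≢0) , eig) =
      (i , vi≢0 ∘ trans (v≗v′ i)) ,
      λ j → trans (Σℚ-cong (λ l → cong (H d j l *_) (sym (v≗v′ l)))) (trans (eig j) (cong (λ′ *_) (v≗v′ j)))

  rescaling : ∀ {k} → Fin k → ℚ → Vector ℚ k
  rescaling p ε l with toℕ l ℕ.≟ toℕ p
  ... | yes _ = ε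
  ... | no _  = 1ℚ

  rescaling≢0 : ∀ {k} (p : Fin k) {ε} → ε ≢ 0ℚ → ∀ l → rescaling p ε l ≢ 0ℚ
  rescaling≢0 p ε≢0 l with toℕ l ℕ.≟ toℕ p
  ... | yes _ = ε≢0
  ... | no _  = 1≢0

  rescaling-replaceAt : ∀ {k n} (w : Fin k → Vector ℚ n) p ε l i →
                        rescaling p ε l * w l i ≡ replaceAt (toℕ p) (λ i → ε * w p i) w l i
  rescaling-replaceAt w p ε l i with toℕ l ℕ.≟ toℕ p
  ... | yes l≡p = cong (λ l → ε * w l i) (Fin.toℕ-injective l≡p)
  ... | no _    = *-identityˡ (w l i)

  eigenbasis-rescale : ∀ {d w} p ε → ε ≢ 0ℚ → IsEigenbasis d w → IsEigenbasis d (replaceAt (toℕ p) (λ i → ε * w p i) w)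
  eigenbasis-rescale {d} {w} p ε ε≢0 (basis , eigen) =
    IsEigenbasis-cong (rescaling-replaceAt w p ε) (IsBasis-scale {b = w} (rescaling p ε) (rescaling≢0 p ε≢0) basis , eigen′)
    where
    eigen′ : ∀ l → IsEigenvector (H d) (eigval l) (λ i → rescaling p ε l * w l i)
    eigen′ l = eigenvector-scale (H d) {eigval l} {w l} (rescaling p ε l) (rescaling≢0 p ε≢0 l) (eigen l)

  -- The matrix (a b; c d) has the right inverse (α₁ α₂; β₁ β₂), so its determinant δ is nonzero,
  -- and multiplying by the adjugate recovers δ·x and δ·y.
  right-invertible⇒injective₂ : ∀ {a b c d α₁ β₁ α₂ β₂} →
    α₁ * a + β₁ * b ≡ 1ℚ → α₁ * c + β₁ * d ≡ 0ℚ → α₂ * a + β₂ * b ≡ 0ℚ → α₂ * c + β₂ * d ≡ 1ℚ →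
    ∀ {x y} → x * a + y * b ≡ 0ℚ → x * c + y * d ≡ 0ℚ → x ≡ 0ℚ × y ≡ 0ℚ
  right-invertible⇒injective₂ {a} {b} {c} {d} {α₁} {β₁} {α₂} {β₂} e₁₁ e₁₂ e₂₁ e₂₂ {x} {y} z₁ z₂ =
    p≢0∧p*q≡0⇒q≡0 δ≢0 δx≡0 , p≢0∧p*q≡0⇒q≡0 δ≢0 δy≡0
    where
    open ≡-Reasoning
    δ = a * d - b * c
    det-product : ∀ a b c d α₁ β₁ α₂ β₂ → (a * d - b * c) * (α₁ * β₂ - α₂ * β₁) ≡
      (α₁ * a + β₁ * b) * (α₂ * c + β₂ * d) - (α₂ * a + β₂ * b) * (α₁ * c + β₁ * d)
    det-product = solve-∀ ℚ-ring
    adjugate₁ : ∀ a b c d x y → (a * d - b * c) * x ≡ d * (x * a + y * b) - b * (x * c + y * d)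
    adjugate₁ = solve-∀ ℚ-ring
    adjugate₂ : ∀ a b c d x y → (a * d - b * c) * y ≡ a * (x * c + y * d) - c * (x * a + y * b)
    adjugate₂ = solve-∀ ℚ-ring
    zero-combination : ∀ p q → p * 0ℚ - q * 0ℚ ≡ 0ℚ
    zero-combination = solve-∀ ℚ-ring
    δ≢0 : δ ≢ 0ℚ
    δ≢0 δ≡0 = 1≢0 (begin
      1ℚ                                 ≡⟨⟩
      1ℚ * 1ℚ - 0ℚ * 0ℚ                  ≡⟨ cong₂ (λ p q → p - q) (cong₂ _*_ e₁₁ e₂₂) (cong₂ _*_ e₂₁ e₁₂) ⟨
      (α₁ * a + β₁ * b) * (α₂ * c + β₂ * d) - (α₂ * a + β₂ * b) * (α₁ * c + β₁ * d)
                                         ≡⟨ det-product a b c d α₁ β₁ α₂ β₂ ⟨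
      δ * (α₁ * β₂ - α₂ * β₁)            ≡⟨ cong (_* (α₁ * β₂ - α₂ * β₁)) δ≡0 ⟩
      0ℚ * (α₁ * β₂ - α₂ * β₁)           ≡⟨ *-zeroˡ (α₁ * β₂ - α₂ * β₁) ⟩
      0ℚ                                 ∎)
    δx≡0 : δ * x ≡ 0ℚ
    δx≡0 = begin
      δ * x                                       ≡⟨ adjugate₁ a b c d x y ⟩
      d * (x * a + y * b) - b * (x * c + y * d)   ≡⟨ cong₂ (λ p q → d * p - b * q) z₁ z₂ ⟩
      d * 0ℚ - b * 0ℚ                             ≡⟨ zero-combination d b ⟩
      0ℚ                                          ∎
    δy≡0 : δ * y ≡ 0ℚ
    δy≡0 = begin
      δ * y                                       ≡⟨ adjugate₂ a b c d x y ⟩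
      a * (x * c + y * d) - c * (x * a + y * b)   ≡⟨ cong₂ (λ p q → a * q - c * p) z₁ z₂ ⟩
      a * 0ℚ - c * 0ℚ                             ≡⟨ zero-combination a c ⟩
      0ℚ                                          ∎

  unit : ∀ {n} → Fin n → Vector ℚ n
  unit r i with i Fin.≟ r
  ... | yes _ = 1ℚ
  ... | no _  = 0ℚ

  unit-diagonal : ∀ {n} (r : Fin n) → unit r r ≡ 1ℚ
  unit-diagonal r with r Fin.≟ r
  ... | yes _   = refl
  ... | no r≢r = contradiction refl r≢r

  unit-off-diagonal : ∀ {n} {r s : Fin n} → s ≢ r → unit r s ≡ 0ℚ
  unit-off-diagonal {r = r} {s} s≢r with s Fin.≟ r
  ... | yes s≡r = contradiction s≡r s≢r
  ... | no _    = refl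

  module TwoCoordinates {m n : ℕ} (b : Fin (suc (suc m)) → Vector ℚ n) (basis : IsBasis b)
                        (r s : Fin n) (r≢s : r ≢ s)
                        (tail-vanishes : ∀ k → b (suc (suc k)) r ≡ 0ℚ × b (suc (suc k)) s ≡ 0ℚ) where

    private
      independent = proj₁ basis
      spanning    = proj₂ basis
      b₀ = b zero
      b₁ = b (suc zero)

    tail : Vector ℚ (suc (suc m)) → Vector ℚ n
    tail γ i = Σℚ (λ k → γ (suc (suc k)) * b (suc (suc k)) i)

    tail-vanishing-at : ∀ t → (∀ k → b (suc (suc k)) t ≡ 0ℚ) → ∀ γ → tail γ t ≡ 0ℚ
    tail-vanishing-at t b≡0 γ = Σℚ-zero (λ k → trans (cong (γ (suc (suc k)) *_) (b≡0 k)) (*-zeroʳ (γ (suc (suc k)))))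

    tail-r : ∀ γ → tail γ r ≡ 0ℚ
    tail-r = tail-vanishing-at r (proj₁ ∘ tail-vanishes)

    tail-s : ∀ γ → tail γ s ≡ 0ℚ
    tail-s = tail-vanishing-at s (proj₂ ∘ tail-vanishes)

    lincomb-at : ∀ γ (x y : Vector ℚ n) t → tail γ t ≡ 0ℚ →
                 lincomb γ (x ∷ y ∷ λ k → b (suc (suc k))) t ≡ γ zero * x t + γ (suc zero) * y t
    lincomb-at γ x y t tail≡0 = begin
      γ zero * x t + (γ (suc zero) * y t + tail γ t) ≡⟨ cong (λ z → γ zero * x t + (γ (suc zero) * y t + z)) tail≡0 ⟩
      γ zero * x t + (γ (suc zero) * y t + 0ℚ)       ≡⟨ cong (γ zero * x t +_) (+-identityʳ _) ⟩
      γ zero * x t + γ (suc zero) * y t              ∎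
      where open ≡-Reasoning

    first-of : ∀ p q → p * 1ℚ + q * 0ℚ ≡ p
    first-of = solve-∀ ℚ-ring

    second-of : ∀ p q → p * 0ℚ + q * 1ℚ ≡ q
    second-of = solve-∀ ℚ-ring

    -- u₁ and u₂ are the parts along b₀, b₁ of the unit vectors at r and s; the remaining basis
    -- vectors vanish at r and s, so u₁ and u₂ take the values (1, 0) and (0, 1) there.
    cᵣ cₛ : Vector ℚ (suc (suc m))
    cᵣ = proj₁ (spanning (unit r))
    cₛ = proj₁ (spanning (unit s))

    u₁ u₂ : Vector ℚ n
    u₁ i = cᵣ zero * b₀ i + cᵣ (suc zero) * b₁ i
    u₂ i = cₛ zero * b₀ i + cₛ (suc zero) * b₁ i

    u₁-r : u₁ r ≡ 1ℚ
    u₁-r = trans (sym (lincomb-at cᵣ b₀ b₁ r (tail-r cᵣ))) (trans (proj₂ (spanning (unit r)) r) (unit-diagonal r))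

    u₁-s : u₁ s ≡ 0ℚ
    u₁-s = trans (sym (lincomb-at cᵣ b₀ b₁ s (tail-s cᵣ)))
                 (trans (proj₂ (spanning (unit r)) s) (unit-off-diagonal (r≢s ∘ sym)))

    u₂-r : u₂ r ≡ 0ℚ
    u₂-r = trans (sym (lincomb-at cₛ b₀ b₁ r (tail-r cₛ))) (trans (proj₂ (spanning (unit s)) r) (unit-off-diagonal r≢s))

    u₂-s : u₂ s ≡ 1ℚ
    u₂-s = trans (sym (lincomb-at cₛ b₀ b₁ s (tail-s cₛ))) (trans (proj₂ (spanning (unit s)) s) (unit-diagonal s))

    leading-coefficients-zero : ∀ γ → lincomb γ b r ≡ 0ℚ → lincomb γ b s ≡ 0ℚ →
                                γ zero ≡ 0ℚ × γ (suc zero) ≡ 0ℚ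
    leading-coefficients-zero γ at-r at-s =
      right-invertible⇒injective₂ {b₀ r} {b₁ r} {b₀ s} {b₁ s} {cᵣ zero} {cᵣ (suc zero)} {cₛ zero} {cₛ (suc zero)}
        u₁-r u₁-s u₂-r u₂-s
      (trans (sym (lincomb-at γ b₀ b₁ r (tail-r γ))) at-r) (trans (sym (lincomb-at γ b₀ b₁ s (tail-s γ))) at-s)

    lincomb-tail : ∀ γ → γ zero ≡ 0ℚ → γ (suc zero) ≡ 0ℚ → ∀ (x y : Vector ℚ n) i →
                   lincomb γ (x ∷ y ∷ λ k → b (suc (suc k))) i ≡ tail γ i
    lincomb-tail γ γ₀≡0 γ₁≡0 x y i = begin
      γ zero * x i + (γ (suc zero) * y i + tail γ i) ≡⟨ cong₂ (λ p q → p * x i + (q * y i + tail γ i)) γ₀≡0 γ₁≡0 ⟩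
      0ℚ * x i + (0ℚ * y i + tail γ i)               ≡⟨ cong₂ (λ p q → p + (q + tail γ i)) (*-zeroˡ (x i)) (*-zeroˡ (y i)) ⟩
      0ℚ + (0ℚ + tail γ i)                           ≡⟨ trans (+-identityˡ _) (+-identityˡ _) ⟩
      tail γ i                                       ∎
      where open ≡-Reasoning

    replaced : Fin (suc (suc m)) → Vector ℚ n
    replaced = u₁ ∷ u₂ ∷ (λ k → b (suc (suc k)))

    replaced-basis : IsBasis replaced
    replaced-basis = independent′ , spanning′
      where
      open ≡-Reasoning
      independent′ : ∀ γ → (∀ i → lincomb γ replaced i ≡ 0ℚ) → ∀ l → γ l ≡ 0ℚ
      independent′ γ γ·b′≡0 = independent γ γ·b≡0
        where
        γ₀≡0 : γ zero ≡ 0ℚ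
        γ₀≡0 = begin
          γ zero                                  ≡⟨ first-of (γ zero) (γ (suc zero)) ⟨
          γ zero * 1ℚ + γ (suc zero) * 0ℚ         ≡⟨ cong₂ (λ p q → γ zero * p + γ (suc zero) * q) u₁-r u₂-r ⟨
          γ zero * u₁ r + γ (suc zero) * u₂ r     ≡⟨ lincomb-at γ u₁ u₂ r (tail-r γ) ⟨
          lincomb γ replaced r                    ≡⟨ γ·b′≡0 r ⟩
          0ℚ                                      ∎
        γ₁≡0 : γ (suc zero) ≡ 0ℚ
        γ₁≡0 = begin
          γ (suc zero)                            ≡⟨ second-of (γ zero) (γ (suc zero)) ⟨
          γ zero * 0ℚ + γ (suc zero) * 1ℚ         ≡⟨ cong₂ (λ p q → γ zero * p + γ (suc zero) * q) u₁-s u₂-s ⟨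
          γ zero * u₁ s + γ (suc zero) * u₂ s     ≡⟨ lincomb-at γ u₁ u₂ s (tail-s γ) ⟨
          lincomb γ replaced s                    ≡⟨ γ·b′≡0 s ⟩
          0ℚ                                      ∎
        γ·b≡0 : ∀ i → lincomb γ b i ≡ 0ℚ
        γ·b≡0 i = begin
          lincomb γ b i          ≡⟨ lincomb-tail γ γ₀≡0 γ₁≡0 b₀ b₁ i ⟩
          tail γ i               ≡⟨ lincomb-tail γ γ₀≡0 γ₁≡0 u₁ u₂ i ⟨
          lincomb γ replaced i   ≡⟨ γ·b′≡0 i ⟩
          0ℚ                     ∎
      spanning′ : ∀ v → ∃ λ γ → ∀ i → lincomb γ replaced i ≡ v i
      spanning′ v = (v r ∷ v s ∷ λ k → γ (suc (suc k))) , λ i → begin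
        v r * u₁ i + (v s * u₂ i + tail γ i)   ≡⟨ cong (λ t → v r * u₁ i + (v s * u₂ i + t)) (tail≡v′ i) ⟩
        v r * u₁ i + (v s * u₂ i + v′ i)       ≡⟨ restore (v i) (v r * u₁ i) (v s * u₂ i) ⟩
        v i                                    ∎
        where
        v′ : Vector ℚ n
        v′ i = v i - (v r * u₁ i + v s * u₂ i)
        γ = proj₁ (spanning v′)
        γ·b≡v′ = proj₂ (spanning v′)
        v′-vanishes : ∀ t p q → u₁ t ≡ p → u₂ t ≡ q → v r * p + v s * q ≡ v t → v′ t ≡ 0ℚ
        v′-vanishes t p q u₁t u₂t combination = begin
          v t - (v r * u₁ t + v s * u₂ t)   ≡⟨ cong₂ (λ p q → v t - (v r * p + v s * q)) u₁t u₂t ⟩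
          v t - (v r * p + v s * q)         ≡⟨ cong (λ z → v t - z) combination ⟩
          v t - v t                         ≡⟨ +-inverseʳ (v t) ⟩
          0ℚ                                ∎
        v′-r : v′ r ≡ 0ℚ
        v′-r = v′-vanishes r 1ℚ 0ℚ u₁-r u₂-r (first-of (v r) (v s))
        v′-s : v′ s ≡ 0ℚ
        v′-s = v′-vanishes s 0ℚ 1ℚ u₁-s u₂-s (second-of (v r) (v s))
        leading≡0 = leading-coefficients-zero γ (trans (γ·b≡v′ r) v′-r) (trans (γ·b≡v′ s) v′-s)
        tail≡v′ : ∀ i → tail γ i ≡ v′ i
        tail≡v′ i = trans (sym (lincomb-tail γ (proj₁ leading≡0) (proj₂ leading≡0) b₀ b₁ i)) (γ·b≡v′ i)
        restore : ∀ x a b → a + (b + (x - (a + b))) ≡ x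
        restore = solve-∀ ℚ-ring

  !-mono-≤ : ∀ {m n} → m ℕ.≤ n → m ! ℕ.≤ n !
  !-mono-≤ {n = n} z≤n       = ℕ.1≤n! n
  !-mono-≤ (s≤s {m} {n} m≤n) = ℕ.*-mono-≤ (s≤s m≤n) (!-mono-≤ m≤n)

  !-mono-< : ∀ {m n} → m ℕ.< n → 2 ℕ.≤ n → m ! ℕ.< n !
  !-mono-< {m} {suc n} (s≤s m≤n) (s≤s 1≤n) =
    ℕ.≤-<-trans (!-mono-≤ m≤n) (ℕ.m<m+n (n !) (ℕ.*-mono-≤ 1≤n (ℕ.1≤n! n)))

  -- The eigenvalue 1 at positions 0 and 1 is 0! = 1!.
  eigval≡! : ∀ {d} (k : Fin (suc d)) → eigval k ≡ ℕ→ℚ (toℕ k !)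
  eigval≡! k with toℕ k
  ... | zero        = refl
  ... | suc zero    = refl
  ... | suc (suc _) = refl

  toℕ<d : ∀ {d} (j : Fin (suc d)) → j ≢ fromℕ d → toℕ j ℕ.< d
  toℕ<d {d} j j≢d =
    ℕ.≤∧≢⇒< (ℕ.≤-pred (Fin.toℕ<n j)) (λ j≡d → j≢d (Fin.toℕ-injective (trans j≡d (sym (Fin.toℕ-fromℕ d)))))

  H-nonneg : ∀ d i j → 0ℚ ≤ H d i j
  H-nonneg d i j = ℕ→ℚ-mono-≤ {n = A (suc d) (toℕ i) (suc (toℕ j))} z≤n

  H-column-sum : ∀ d j → sum (λ i → H d i j) ≡ ℕ→ℚ (d !)
  H-column-sum d j = trans (sym (ℕ→ℚ-sum {suc d} (λ i → A (suc d) (toℕ i) (suc (toℕ j)))))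
                           (cong ℕ→ℚ (A-column-sum d (suc (toℕ j)) (s≤s z≤n) (Fin.toℕ<n j)))

  H-row₀-off : ∀ d j → j ≢ zero → H d zero j ≡ 0ℚ
  H-row₀-off d zero    j≢0 = contradiction refl j≢0
  H-row₀-off d (suc j) _   = cong ℕ→ℚ (A-row₀-off d (suc (suc (toℕ j))) (s≤s (s≤s z≤n)))

  H-row-max-off : ∀ d j → j ≢ fromℕ d → H d (fromℕ d) j ≡ 0ℚ
  H-row-max-off d j j≢d = trans (cong (λ t → ℕ→ℚ (A (suc d) t (suc (toℕ j)))) (Fin.toℕ-fromℕ d))
                                (cong ℕ→ℚ (A-row-max-off d (suc (toℕ j)) (toℕ<d j j≢d)))

  H-row-max-diag : ∀ d → H d (fromℕ d) (fromℕ d) ≡ ℕ→ℚ (A (suc d) d (suc d))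
  H-row-max-diag d = cong (λ t → ℕ→ℚ (A (suc d) t (suc t))) (Fin.toℕ-fromℕ d)

  H-row₁-pos : ∀ d j → 0 ℕ.< toℕ j → toℕ j ℕ.< suc d → 0ℚ < H (suc d) (suc zero) j
  H-row₁-pos d j 0<j j<d = ℕ→ℚ-mono-< (A-row₁-pos (suc (suc d)) (suc (toℕ j)) (s≤s 0<j) (s≤s (ℕ.<⇒≤ j<d)))

  H-column₁-pos : ∀ d i → 0 ℕ.< toℕ i → toℕ i ℕ.< suc d → 0ℚ < H (suc d) i (suc zero)
  H-column₁-pos d i 0<i i<d =
    ℕ→ℚ-mono-< (A-column₂-pos (suc (suc d)) (toℕ i) 0<i (subst (ℕ._≤ suc (suc d)) (ℕ.+-comm 2 (toℕ i)) (s≤s i<d)))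

  small-entry≢eigval : ∀ {d a} (k : Fin (suc d)) → a ℕ.≤ 1 → 2 ℕ.≤ toℕ k → ℕ→ℚ a ≢ eigval k
  small-entry≢eigval k a≤1 2≤k a≡ = ℕ.<-irrefl (ℕ→ℚ-injective (trans a≡ (eigval≡! k)))
    (ℕ.≤-<-trans a≤1 (!-mono-< (ℕ.<-≤-trans (s≤s z≤n) 2≤k) 2≤k))

  eigval≢d! : ∀ {d} (k : Fin (suc d)) → 2 ℕ.≤ d → k ≢ fromℕ d → eigval k ≢ ℕ→ℚ (d !)
  eigval≢d! k 2≤d k≢d eq = ℕ.<-irrefl (ℕ→ℚ-injective (trans (sym (eigval≡! k)) eq)) (!-mono-< (toℕ<d k k≢d) 2≤d)

  sum-hvec : ∀ {n d} (Δ : SimplicialComplex n d) → sum (hvec Δ) ≡ ℕ→ℚ (fvec Δ d)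
  sum-hvec {d = d} Δ = trans (sym (ℤ→ℚ-∑ℤ (suc d) (hvecℤ Δ))) (cong ℤ→ℚ (∑ℤ-hvec Δ))

  higher-eigenvectors-vanish-at-ends : ∀ d w → IsEigenbasis d w →
                                       ∀ k → 2 ℕ.≤ toℕ k → w k zero ≡ 0ℚ × w k (fromℕ d) ≡ 0ℚ
  higher-eigenvectors-vanish-at-ends d w (_ , eigen) k 2≤k =
    eigenvector-isolated-row (H d) zero (H-row₀-off d)
      (small-entry≢eigval k (A-row₀-diag≤1 (suc d)) 2≤k) (proj₂ (eigen k)) ,
    eigenvector-isolated-row (H d) (fromℕ d) (H-row-max-off d)
      (small-entry≢eigval k (A-row-max-diag≤1 d) 2≤k ∘ trans (sym (H-row-max-diag d))) (proj₂ (eigen k))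

  h-vector-top-coefficient≢0 : ∀ d → 2 ℕ.≤ d → ∀ w → IsEigenbasis d w →
    ∀ n (Δ : SimplicialComplex n d) a → (∀ i → hvec Δ i ≡ lincomb a w i) → a (fromℕ d) ≢ 0ℚ
  h-vector-top-coefficient≢0 d 2≤d w (_ , eigen) n Δ a h≡aw a-top≡0 =
    <-irrefl (sym facets≡0) (ℕ→ℚ-mono-< (fvec-facets-positive Δ))
    where
    open ≡-Reasoning
    facets≡0 : ℕ→ℚ (fvec Δ d) ≡ 0ℚ
    facets≡0 = begin
      ℕ→ℚ (fvec Δ d)                        ≡⟨ sum-hvec Δ ⟨
      sum (hvec Δ)                           ≡⟨ sum-cong-≗ h≡aw ⟩
      sum (lincomb a w)                      ≡⟨ sum-lincomb a w ⟩
      sum (λ l → a l * sum (w l))            ≡⟨ sum-single (λ l → a l * sum (w l)) (fromℕ d) other-terms ⟩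
      a (fromℕ d) * sum (w (fromℕ d))        ≡⟨ cong (_* sum (w (fromℕ d))) a-top≡0 ⟩
      0ℚ * sum (w (fromℕ d))                 ≡⟨ *-zeroˡ (sum (w (fromℕ d))) ⟩
      0ℚ                                     ∎
      where
      other-terms : ∀ l → l ≢ fromℕ d → a l * sum (w l) ≡ 0ℚ
      other-terms l l≢d =
        trans (cong (a l *_) (eigenvector-sum (H d) (H-column-sum d) (eigval≢d! l 2≤d l≢d) (proj₂ (eigen l))))
              (*-zeroʳ (a l))

  eigenvalue-one-normal-form : ∀ e w → IsEigenbasis (suc (suc e)) w →
    ∃ λ u₁ → ∃ λ u₂ → IsEigenbasis (suc (suc e)) (replaceAt 1 u₂ (replaceAt 0 u₁ w))
      × (u₁ zero ≡ 1ℚ) × (u₁ (fromℕ (suc (suc e))) ≡ 0ℚ) × (u₂ zero ≡ 0ℚ) × (u₂ (fromℕ (suc (suc e))) ≡ 1ℚ)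
  eigenvalue-one-normal-form e w EB@(basis , eigen) =
    u₁ , u₂ , IsEigenbasis-cong as-replaceAt (replaced-basis , eigen′) , u₁-r , u₁-s , u₂-r , u₂-s
    where
    d = suc (suc e)
    open TwoCoordinates w basis zero (fromℕ d) (λ ())
      (λ k → higher-eigenvectors-vanish-at-ends d w EB (suc (suc k)) (s≤s (s≤s z≤n)))
    eigen₀₁ : ∀ α β i → (H d · (λ j → α * w zero j + β * w (suc zero) j)) i ≡ 1ℚ * (α * w zero i + β * w (suc zero) i)
    eigen₀₁ = eigenvector-combination (H d) {1ℚ} {w zero} {w (suc zero)} (proj₂ (eigen zero)) (proj₂ (eigen (suc zero)))
    eigen′ : ∀ l → IsEigenvector (H d) (eigval l) (replaced l)
    eigen′ zero          = (zero , λ u₁≡0 → 1≢0 (trans (sym u₁-r) u₁≡0)) , eigen₀₁ (cᵣ zero) (cᵣ (suc zero))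
    eigen′ (suc zero)    = (fromℕ d , λ u₂≡0 → 1≢0 (trans (sym u₂-s) u₂≡0)) , eigen₀₁ (cₛ zero) (cₛ (suc zero))
    eigen′ (suc (suc l)) = eigen (suc (suc l))
    as-replaceAt : ∀ l i → replaced l i ≡ replaceAt 1 u₂ (replaceAt 0 u₁ w) l i
    as-replaceAt zero          i = refl
    as-replaceAt (suc zero)    i = refl
    as-replaceAt (suc (suc l)) i = refl

  top-eigenvalue : ∀ {d w} → IsEigenbasis d w → ∀ i → (H d · w (fromℕ d)) i ≡ ℕ→ℚ (d !) * w (fromℕ d) i
  top-eigenvalue {d} {w} (_ , eigen) i = trans (proj₂ (eigen (fromℕ d)) i)
    (cong (_* w (fromℕ d) i) (trans (eigval≡! (fromℕ d)) (cong (λ t → ℕ→ℚ (t !)) (Fin.toℕ-fromℕ d))))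

  support-interior : ∀ {d} (v : Vector ℚ (suc d)) → v zero ≡ 0ℚ → v (fromℕ d) ≡ 0ℚ →
                     ∀ p → v p ≢ 0ℚ → 0 ℕ.< toℕ p × toℕ p ℕ.< d
  support-interior v v₀≡0 vd≡0 zero    v₀≢0 = contradiction v₀≡0 v₀≢0
  support-interior v v₀≡0 vd≡0 (suc p) vp≢0 = s≤s z≤n , toℕ<d (suc p) (λ p≡d → vp≢0 (trans (cong v p≡d) vd≡0))

  top-eigenvector-ends : ∀ e w → IsEigenbasis (suc (suc e)) w →
    w (fromℕ (suc (suc e))) zero ≡ 0ℚ × w (fromℕ (suc (suc e))) (fromℕ (suc (suc e))) ≡ 0ℚ
  top-eigenvector-ends e w EB =
    higher-eigenvectors-vanish-at-ends d w EB (fromℕ d) (subst (2 ℕ.≤_) (sym (Fin.toℕ-fromℕ d)) (s≤s (s≤s z≤n)))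
    where d = suc (suc e)

  top-eigenvector-sign-coherent : ∀ e w → IsEigenbasis (suc (suc e)) w →
    ∀ p q → 0ℚ < w (fromℕ (suc (suc e))) p → w (fromℕ (suc (suc e))) q < 0ℚ → ⊥
  top-eigenvector-sign-coherent e w EB p q 0<xp xq<0 =
    eigenvector-no-cancellation (H d) (H-nonneg d) {ℕ→ℚ (d !)} {x} (H-column-sum d) (ℕ→ℚ-mono-≤ {n = d !} z≤n)
      (top-eigenvalue EB) (suc zero) p q
      (pos*pos (H-row₁-pos (suc e) p (proj₁ p-interior) (proj₂ p-interior)) 0<xp)
      (pos*neg (H-row₁-pos (suc e) q (proj₁ q-interior) (proj₂ q-interior)) xq<0)
    where
    d = suc (suc e)
    x = w (fromℕ d)
    x-ends = top-eigenvector-ends e w EB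
    p-interior = support-interior x (proj₁ x-ends) (proj₂ x-ends) p (λ xp≡0 → <-irrefl (sym xp≡0) 0<xp)
    q-interior = support-interior x (proj₁ x-ends) (proj₂ x-ends) q (λ xq≡0 → <-irrefl xq≡0 xq<0)

  nonneg-top-eigenvector-positive : ∀ e (y : Vector ℚ (suc (suc (suc e)))) →
    (∀ i → (H (suc (suc e)) · y) i ≡ ℕ→ℚ (suc (suc e) !) * y i) → (∀ j → 0ℚ ≤ y j) →
    y zero ≡ 0ℚ → y (fromℕ (suc (suc e))) ≡ 0ℚ → ∀ p → 0ℚ < y p →
    ∀ k → 0 ℕ.< toℕ k → toℕ k ℕ.< suc (suc e) → 0ℚ < y k
  nonneg-top-eigenvector-positive e y eigen y≥0 y₀≡0 yd≡0 p 0<yp k 0<k k<d =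
    propagate (H-column₁-pos (suc e) k 0<k k<d) (propagate (H-row₁-pos (suc e) p 0<p p<d) 0<yp)
    where
    d = suc (suc e)
    propagate : ∀ {i j} → 0ℚ < H d i j → 0ℚ < y j → 0ℚ < y i
    propagate = eigenvector-positive (H d) (H-nonneg d) (ℕ→ℚ-mono-< (ℕ.1≤n! d)) y≥0 eigen
    p-interior = support-interior y y₀≡0 yd≡0 p (λ yp≡0 → <-irrefl (sym yp≡0) 0<yp)
    0<p = proj₁ p-interior
    p<d = proj₂ p-interior

  positive-top-eigenvector : ∀ e w → IsEigenbasis (suc (suc e)) w →
    ∃ λ v → IsEigenbasis (suc (suc e)) (replaceAt (suc (suc e)) v w)
      × (v zero ≡ 0ℚ) × (v (fromℕ (suc (suc e))) ≡ 0ℚ)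
      × (∀ k → 0 ℕ.< toℕ k → toℕ k ℕ.< suc (suc e) → 0ℚ < v k)
  positive-top-eigenvector e w EB@(_ , eigen) =
    y , subst (λ t → IsEigenbasis d (replaceAt t y w)) (Fin.toℕ-fromℕ d) (eigenbasis-rescale (fromℕ d) ε ε≢0 EB) ,
    y₀≡0 , yd≡0 , nonneg-top-eigenvector-positive e y y-eigen y≥0 y₀≡0 yd≡0 p 0<yp
    where
    d = suc (suc e)
    x = w (fromℕ d)
    sign = same-sign⇒nonneg-multiple x (proj₁ (eigen (fromℕ d))) (top-eigenvector-sign-coherent e w EB)
    ε    = proj₁ sign
    ε≢0  = proj₁ (proj₂ sign)
    y≥0  = proj₁ (proj₂ (proj₂ sign))
    p    = proj₁ (proj₂ (proj₂ (proj₂ sign)))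
    0<yp = proj₂ (proj₂ (proj₂ (proj₂ sign)))
    y : Vector ℚ (suc d)
    y i = ε * x i
    x-ends = top-eigenvector-ends e w EB
    y₀≡0 = trans (cong (ε *_) (proj₁ x-ends)) (*-zeroʳ ε)
    yd≡0 = trans (cong (ε *_) (proj₂ x-ends)) (*-zeroʳ ε)
    y-eigen : ∀ i → (H d · y) i ≡ ℕ→ℚ (d !) * y i
    y-eigen i = trans (·-scale (H d) ε x i) (trans (cong (ε *_) (top-eigenvalue EB i)) (x∙yz≈y∙xz ε (ℕ→ℚ (d !)) (x i)))

open Eigenbasis using (h-vector-top-coefficient≢0; higher-eigenvectors-vanish-at-ends; eigenvalue-one-normal-form;
                       positive-top-eigenvector)
open import Data.Nat using (ℕ; zero; suc; s≤s; _≤_; _<_)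
open import Data.Fin using (Fin; zero; toℕ; fromℕ)
open import Data.Rational using (ℚ; 0ℚ; 1ℚ) renaming (_<_ to _<ℚ_)
open import Data.Vec.Functional using (Vector)
open import Data.Product using (∃; _×_; _,_)
open import Relation.Binary.PropositionalEquality using (_≡_; _≢_)

lemma4p5 : (d : ℕ) → 2 ≤ d →
  (w : Fin (Data.Nat.suc d) → Vector ℚ (Data.Nat.suc d)) → IsEigenbasis d w →
  -- (i)
  (∀ (n : ℕ) (Δ : SimplicialComplex n d) (a : Vector ℚ (Data.Nat.suc d)) →
     (∀ i → hvec Δ i ≡ lincomb a w i) → a (fromℕ d) ≢ 0ℚ)
  -- (ii)
  × (∀ k → 2 ≤ toℕ k → (w k zero ≡ 0ℚ) × (w k (fromℕ d) ≡ 0ℚ))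
  -- (iii)
  × (∃ λ (u₁ : Vector ℚ (Data.Nat.suc d)) → ∃ λ (u₂ : Vector ℚ (Data.Nat.suc d)) →
       IsEigenbasis d (replaceAt 1 u₂ (replaceAt 0 u₁ w))
       × (u₁ zero ≡ 1ℚ) × (u₁ (fromℕ d) ≡ 0ℚ)
       × (u₂ zero ≡ 0ℚ) × (u₂ (fromℕ d) ≡ 1ℚ))
  -- (iv)
  × (∃ λ (v : Vector ℚ (Data.Nat.suc d)) →
       IsEigenbasis d (replaceAt d v w)
       × (v zero ≡ 0ℚ) × (v (fromℕ d) ≡ 0ℚ)
       × (∀ (k : Fin (Data.Nat.suc d)) → 0 < toℕ k → toℕ k < d → 0ℚ <ℚ v k))
lemma4p5 (suc zero) (s≤s ()) w EB
lemma4p5 (suc (suc e)) 2≤d w EB =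
  h-vector-top-coefficient≢0 d 2≤d w EB ,
  higher-eigenvectors-vanish-at-ends d w EB ,
  eigenvalue-one-normal-form e w EB ,
  positive-top-eigenvector e w EB
  where d = suc (suc e)
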